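{- Let $H$ be a finite graph whose vertex set is partitioned into two non-empty sets $A_1,A_2$ such that the number $e(A_1,A_2)$ of edges of $H$ between $A_1$ and $A_2$ is even. Let $k=|A_1|$, $r_1(m)=r_{H[A_1]}(m)$ and $r_2(m)=r_{H[A_2]}(m)$. Then for all sufficiently large $n$, $$r_H(n)\geq\max_{m\in[n]}\min\left\{r_1(m),\,r_2(m),\,\exp\!\left(\frac{(\log n-\log m)^2}{3k\log n}\right)\right\}.$$
   Context: $\log$ is the natural logarithm; $H[A]$ is the subgraph of $H$ induced by $A$. $K_n$ is the complete graph on $[n]$. An edge coloring $\chi$ of $K_n$ admits an even-chromatic copy of a graph $H$ if there is an injective map $f\colon V(H)\to[n]$ such that every color appears on an even number (possibly zero) of the edges $f(u)f(v)$, $uv\in E(H)$. $r_H(n)$ is the minimum number of colors in an edge coloring of $K_n$ admitting no even-chromatic copy of $H$ ($\infty$ if none exists). -}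

module Defs where

open import Data.Nat using (ℕ; zero; suc; _+_; _*_; _^_; _≤_; _<_)
open import Data.Nat.Divisibility using (_∣_)
open import Data.Fin using (Fin; zero; suc)
open import Data.Fin.Properties using (_<?_; _≟_)
open import Data.Bool using (Bool; true; false; _∧_; if_then_else_)
open import Data.Sum using (_⊎_; inj₁; inj₂)
open import Data.Product using (Σ; ∃; _×_; _,_)
open import Function.Bundles using (_⤖_; Bijection)
open import Function.Definitions using (Injective)
open import Relation.Nullary using (¬_; does)
open import Relation.Binary.PropositionalEquality using (_≡_)

sumFin : {n : ℕ} → (Fin n → ℕ) → ℕ
sumFin {zero}  f = 0
sumFin {suc n} f = f zero + sumFin (λ i → f (suc i))

record Graph (v : ℕ) : Set where
  field
    adj    : Fin v → Fin v → Bool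
    sym    : ∀ u w → adj u w ≡ adj w u
    irrefl : ∀ u → adj u u ≡ false
open Graph public

-- the subgraph of H induced by the image of an (injective) map ι : Fin k → Fin v,
-- with its vertices relabelled by Fin k
induced : {v k : ℕ} → Graph v → (Fin k → Fin v) → Graph k
induced H ι = record
  { adj    = λ i j → adj H (ι i) (ι j)
  ; sym    = λ i j → sym H (ι i) (ι j)
  ; irrefl = λ i → irrefl H (ι i) }

-- an edge colouring of K_n with colours Fin c (colour of edge {i,j} is χ i j;
-- the diagonal values are irrelevant)
record Colouring (n c : ℕ) : Set where
  field
    col     : Fin n → Fin n → Fin c
    col-sym : ∀ i j → col i j ≡ col j i
open Colouring public

colourCount : {v n c : ℕ} → Graph v → Colouring n c → (Fin v → Fin n) → Fin c → ℕ
colourCount H χ f γ =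
  sumFin λ u → sumFin λ w →
    if does (u <? w) ∧ adj H u w ∧ does (col χ (f u) (f w) ≟ γ) then 1 else 0

EvenChromaticCopy : {v n c : ℕ} → Graph v → Colouring n c → Set
EvenChromaticCopy {v} {n} {c} H χ =
  Σ (Fin v → Fin n) λ f → Injective _≡_ _≡_ f × (∀ (γ : Fin c) → 2 ∣ colourCount H χ f γ)

Avoidable : {v : ℕ} → Graph v → ℕ → ℕ → Set
Avoidable H n c = Σ (Colouring n c) λ χ → ¬ EvenChromaticCopy H χ

-- r_H(n) ≤ c   (r_H(n) = ∞ means this never holds)
rLe : {v : ℕ} → Graph v → ℕ → ℕ → Set
rLe H n c = Σ ℕ λ c' → c' ≤ c × Avoidable H n c'

-- exp((log n − log m)^2 / (3k log n)) ≤ N, for naturals 1 ≤ m ≤ n, n ≥ 2, k ≥ 1,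
-- expressed without real numbers: N ≥ 1 and for all a,b,c,d,
--   a/b < log_n(n/m)  and  c/d < log_N(n/m)   imply   (a/b)(c/d) ≤ 3k.
ExpLe : (k n m N : ℕ) → Set
ExpLe k n m N =
  1 ≤ N ×
  (∀ a b c d → n ^ a * m ^ b < n ^ b → N ^ c * m ^ d < n ^ d → a * c ≤ 3 * k * b * d)

crossEdges : {v k l : ℕ} → Graph v → (Fin k → Fin v) → (Fin l → Fin v) → ℕ
crossEdges H ι₁ ι₂ = sumFin λ i → sumFin λ j → if adj H (ι₁ i) (ι₂ j) then 1 else 0

-- Let χ be a C-colouring of K_n without an even-chromatic copy of H. Copies of
-- H[A₁] and H[A₂] on disjoint vertex sets, all of whose cross edges have one
-- colour, glue to a copy of H whose colour classes have the parities of the two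
-- parts plus, in one class, the even number e(A₁, A₂); so such a configuration
-- is impossible. For C = 1 all injections have the same colour counts, so the
-- first m vertices already witness that H[A₁] or H[A₂] is avoided. For C ≥ 2,
-- dependent random choice (a random T-tuple and the common neighbourhood of its
-- vertices in a suitable colour γ) yields, whenever 2 m C^T ≤ n and
-- 2 C^T n^k (m + k)^T ≤ n^T, an m-set U in which every k-tuple has m common
-- γ-neighbours outside itself: χ restricted to U avoids H[A₁], or a copy of
-- H[A₁] in U has m common neighbours on which χ avoids H[A₂]. When no exponent
-- T satisfies both conditions, comparing the resulting monomials in n, m, C and
-- 2 gives C ≥ exp((log n − log m)² / (3 k log n)), in the form of ExpLe.

module Submission where

open import Data.Bool.Base using (Bool; true; false; _∧_; if_then_else_)
open import Data.Bool.Properties using (∧-identityʳ; ∧-zeroʳ)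
open import Data.Empty using (⊥)
open import Data.Fin.Base using (Fin; zero; suc; _↑ˡ_; _↑ʳ_; splitAt; finToFun; funToFin; inject≤; fromℕ<)
open import Data.Fin.Properties as Finₚ
  using (_≟_; splitAt-↑ˡ; splitAt-↑ʳ; +↔⊎; finToFun-funToFin; inject≤-injective)
open import Data.Nat.Base
open import Data.Nat.Properties hiding (_≟_)
open import Data.Nat.Divisibility using (_∣_; _∣?_; ∣m∣n⇒∣m+n; _∣0)
open import Data.Nat.Tactic.RingSolver using (solve-∀)
open import Data.Product.Base using (Σ; ∃; _×_; _,_; proj₁; proj₂)
open import Data.Sum.Base using (_⊎_; inj₁; inj₂; [_,_]′; map; map₁; map₂)
open import Data.Vec.Functional using (_∷_; [])
open import Function.Base using (_∘_)
open import Function.Bundles using (_↔_; Inverse; mk⤖)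
open import Function.Construct.Composition using (_↔-∘_)
open import Function.Definitions using (Bijective; Injective)
open import Function.Properties.Bijection using (⤖⇒↔)
open import Relation.Binary.Definitions using (tri<; tri≈; tri>)
open import Relation.Binary.PropositionalEquality
open import Relation.Nullary.Decidable using (Dec; yes; no; does; proof; map′; _×-dec_; _→-dec_; dec-true)
open import Relation.Nullary.Reflects using (ofʸ; ofⁿ)
open import Relation.Nullary.Negation.Core using (¬_; contradiction)
open import Algebra.Properties.Semiring.Sum +-*-semiring
  using (sum; ∑-distrib-+; ∑-comm; ∑-permute; *-distribˡ-sum; *-distribʳ-sum)

open import Defs hiding (sym)

open Inverse using (to; from; strictlyInverseˡ; strictlyInverseʳ)

-- Sums over Fin and over tuples

sumFin≡sum : ∀ {n} (f : Fin n → ℕ) → sumFin f ≡ sum f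
sumFin≡sum {zero}  f = refl
sumFin≡sum {suc n} f = cong (f zero +_) (sumFin≡sum (f ∘ suc))

sumFin-cong : ∀ {n} {f g : Fin n → ℕ} → (∀ i → f i ≡ g i) → sumFin f ≡ sumFin g
sumFin-cong {zero}  f≗g = refl
sumFin-cong {suc n} f≗g = cong₂ _+_ (f≗g zero) (sumFin-cong (f≗g ∘ suc))

sumFin-mono-≤ : ∀ {n} {f g : Fin n → ℕ} → (∀ i → f i ≤ g i) → sumFin f ≤ sumFin g
sumFin-mono-≤ {zero}  f≤g = z≤n
sumFin-mono-≤ {suc n} f≤g = +-mono-≤ (f≤g zero) (sumFin-mono-≤ (f≤g ∘ suc))

sumFin-const : ∀ n a → sumFin {n} (λ _ → a) ≡ n * a
sumFin-const zero    a = refl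
sumFin-const (suc n) a = cong (a +_) (sumFin-const n a)

sumFin-zero : ∀ n → sumFin {n} (λ _ → 0) ≡ 0
sumFin-zero n = trans (sumFin-const n 0) (*-zeroʳ n)

≤-sumFin : ∀ {n} (f : Fin n → ℕ) i → f i ≤ sumFin f
≤-sumFin f zero    = m≤m+n _ _
≤-sumFin f (suc i) = ≤-trans (≤-sumFin (f ∘ suc) i) (m≤n+m _ (f zero))

sumFin-<-witness : ∀ {n} (f g : Fin n → ℕ) → sumFin f < sumFin g → ∃ λ i → f i < g i
sumFin-<-witness {suc n} f g Σf<Σg with f zero <? g zero
... | yes f₀<g₀ = zero , f₀<g₀
... | no  f₀≮g₀ with sumFin-<-witness (f ∘ suc) (g ∘ suc)
                      (+-cancelˡ-< (g zero) _ _ (≤-<-trans (+-monoˡ-≤ _ (≮⇒≥ f₀≮g₀)) Σf<Σg))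
...   | i , fi<gi = suc i , fi<gi

sumFin-distrib-+ : ∀ {n} (f g : Fin n → ℕ) → sumFin (λ i → f i + g i) ≡ sumFin f + sumFin g
sumFin-distrib-+ f g = begin
  sumFin (λ i → f i + g i) ≡⟨ sumFin≡sum (λ i → f i + g i) ⟩
  sum (λ i → f i + g i)    ≡⟨ ∑-distrib-+ f g ⟩
  sum f + sum g            ≡⟨ cong₂ _+_ (sumFin≡sum f) (sumFin≡sum g) ⟨
  sumFin f + sumFin g      ∎
  where open ≡-Reasoning

sumFin-comm : ∀ {m n} (f : Fin m → Fin n → ℕ) →
  sumFin (λ i → sumFin (f i)) ≡ sumFin (λ j → sumFin (λ i → f i j))
sumFin-comm f = begin
  sumFin (λ i → sumFin (f i))              ≡⟨ double f ⟩
  sum (λ i → sum (f i))                    ≡⟨ ∑-comm f ⟩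
  sum (λ j → sum (λ i → f i j))            ≡⟨ double (λ j i → f i j) ⟨
  sumFin (λ j → sumFin (λ i → f i j))      ∎
  where
  open ≡-Reasoning
  double : ∀ {m n} (h : Fin m → Fin n → ℕ) → sumFin (λ i → sumFin (h i)) ≡ sum (λ i → sum (h i))
  double h = trans (sumFin-cong (sumFin≡sum ∘ h)) (sumFin≡sum (λ i → sum (h i)))

*-distribˡ-sumFin : ∀ {n} a (f : Fin n → ℕ) → a * sumFin f ≡ sumFin (λ i → a * f i)
*-distribˡ-sumFin a f = begin
  a * sumFin f             ≡⟨ cong (a *_) (sumFin≡sum f) ⟩
  a * sum f                ≡⟨ *-distribˡ-sum a f ⟩
  sum (λ i → a * f i)      ≡⟨ sumFin≡sum (λ i → a * f i) ⟨
  sumFin (λ i → a * f i)   ∎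
  where open ≡-Reasoning

*-distribʳ-sumFin : ∀ {n} a (f : Fin n → ℕ) → sumFin f * a ≡ sumFin (λ i → f i * a)
*-distribʳ-sumFin a f = begin
  sumFin f * a             ≡⟨ cong (_* a) (sumFin≡sum f) ⟩
  sum f * a                ≡⟨ *-distribʳ-sum a f ⟩
  sum (λ i → f i * a)      ≡⟨ sumFin≡sum (λ i → f i * a) ⟨
  sumFin (λ i → f i * a)   ∎
  where open ≡-Reasoning

sumFin-↑ : ∀ k l (f : Fin (k + l) → ℕ) →
  sumFin f ≡ sumFin (λ i → f (i ↑ˡ l)) + sumFin (λ j → f (k ↑ʳ j))
sumFin-↑ zero    l f = refl
sumFin-↑ (suc k) l f = trans (cong (f zero +_) (sumFin-↑ k l (f ∘ suc))) (sym (+-assoc (f zero) _ _))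

sumFin-⊎ : ∀ {k l v} (σ : (Fin k ⊎ Fin l) ↔ Fin v) (f : Fin v → ℕ) →
  sumFin f ≡ sumFin (λ i → f (to σ (inj₁ i))) + sumFin (λ j → f (to σ (inj₂ j)))
sumFin-⊎ {k} {l} σ f = begin
  sumFin f                                  ≡⟨ sumFin≡sum f ⟩
  sum f                                     ≡⟨ ∑-permute f (σ ↔-∘ +↔⊎) ⟩
  sum (λ i → f (to σ (splitAt k i)))        ≡⟨ sumFin≡sum (f ∘ to σ ∘ splitAt k) ⟨
  sumFin (λ i → f (to σ (splitAt k i)))     ≡⟨ sumFin-↑ k l _ ⟩
  sumFin (λ i → f (to σ (splitAt k (i ↑ˡ l)))) + sumFin (λ j → f (to σ (splitAt k (k ↑ʳ j))))
    ≡⟨ cong₂ _+_ (sumFin-cong λ i → cong (f ∘ to σ) (splitAt-↑ˡ k i l))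
                 (sumFin-cong λ j → cong (f ∘ to σ) (splitAt-↑ʳ k l j)) ⟩
  sumFin (λ i → f (to σ (inj₁ i))) + sumFin (λ j → f (to σ (inj₂ j))) ∎
  where open ≡-Reasoning

prodFin : ∀ {n} → (Fin n → ℕ) → ℕ
prodFin {zero}  f = 1
prodFin {suc n} f = f zero * prodFin (f ∘ suc)

prodFin-cong : ∀ {n} {f g : Fin n → ℕ} → (∀ i → f i ≡ g i) → prodFin f ≡ prodFin g
prodFin-cong {zero}  f≗g = refl
prodFin-cong {suc n} f≗g = cong₂ _*_ (f≗g zero) (prodFin-cong (f≗g ∘ suc))

prodFin≤1 : ∀ {n} (f : Fin n → ℕ) → (∀ i → f i ≤ 1) → prodFin f ≤ 1
prodFin≤1 {zero}  f f≤1 = ≤-refl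
prodFin≤1 {suc n} f f≤1 = *-mono-≤ (f≤1 zero) (prodFin≤1 (f ∘ suc) (f≤1 ∘ suc))

prodFin≡1⇒≡1 : ∀ {n} (f : Fin n → ℕ) → prodFin f ≡ 1 → ∀ i → f i ≡ 1
prodFin≡1⇒≡1 f Πf≡1 zero    = m*n≡1⇒m≡1 _ _ Πf≡1
prodFin≡1⇒≡1 f Πf≡1 (suc i) = prodFin≡1⇒≡1 (f ∘ suc) (m*n≡1⇒n≡1 (f zero) _ Πf≡1) i

≡1⇒prodFin≡1 : ∀ {n} (f : Fin n → ℕ) → (∀ i → f i ≡ 1) → prodFin f ≡ 1
≡1⇒prodFin≡1 {zero}  f f≡1 = refl
≡1⇒prodFin≡1 {suc n} f f≡1 = cong₂ _*_ (f≡1 zero) (≡1⇒prodFin≡1 (f ∘ suc) (f≡1 ∘ suc))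

sumTuples : ∀ T {n} → ((Fin T → Fin n) → ℕ) → ℕ
sumTuples zero    f = f []
sumTuples (suc T) f = sumFin λ w → sumTuples T (λ r → f (w ∷ r))

sumTuples-cong : ∀ T {n} {f g : (Fin T → Fin n) → ℕ} → (∀ r → f r ≡ g r) →
  sumTuples T f ≡ sumTuples T g
sumTuples-cong zero    f≗g = f≗g []
sumTuples-cong (suc T) f≗g = sumFin-cong λ w → sumTuples-cong T λ r → f≗g (w ∷ r)

sumTuples-mono-≤ : ∀ T {n} {f g : (Fin T → Fin n) → ℕ} → (∀ r → f r ≤ g r) →
  sumTuples T f ≤ sumTuples T g
sumTuples-mono-≤ zero    f≤g = f≤g []
sumTuples-mono-≤ (suc T) f≤g = sumFin-mono-≤ λ w → sumTuples-mono-≤ T λ r → f≤g (w ∷ r)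

sumTuples-const : ∀ T {n} a → sumTuples T {n} (λ _ → a) ≡ n ^ T * a
sumTuples-const zero        a = sym (+-identityʳ a)
sumTuples-const (suc T) {n} a = begin
  sumFin {n} (λ _ → sumTuples T {n} (λ _ → a)) ≡⟨ sumFin-cong {n} (λ _ → sumTuples-const T {n} a) ⟩
  sumFin {n} (λ _ → n ^ T * a)                  ≡⟨ sumFin-const n (n ^ T * a) ⟩
  n * (n ^ T * a)                               ≡⟨ *-assoc n (n ^ T) a ⟨
  n * n ^ T * a                                 ∎
  where open ≡-Reasoning

sumTuples-distrib-+ : ∀ T {n} (f g : (Fin T → Fin n) → ℕ) →
  sumTuples T (λ r → f r + g r) ≡ sumTuples T f + sumTuples T g
sumTuples-distrib-+ zero    f g = refl
sumTuples-distrib-+ (suc T) f g = trans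
  (sumFin-cong λ w → sumTuples-distrib-+ T (λ r → f (w ∷ r)) (λ r → g (w ∷ r)))
  (sumFin-distrib-+ (λ w → sumTuples T (λ r → f (w ∷ r))) (λ w → sumTuples T (λ r → g (w ∷ r))))

*-distribˡ-sumTuples : ∀ T {n} a (f : (Fin T → Fin n) → ℕ) →
  a * sumTuples T f ≡ sumTuples T (λ r → a * f r)
*-distribˡ-sumTuples zero    a f = refl
*-distribˡ-sumTuples (suc T) a f = trans
  (*-distribˡ-sumFin a (λ w → sumTuples T (λ r → f (w ∷ r))))
  (sumFin-cong λ w → *-distribˡ-sumTuples T a (λ r → f (w ∷ r)))

sumTuples-<-witness : ∀ T {n} (f g : (Fin T → Fin n) → ℕ) →
  sumTuples T f < sumTuples T g → ∃ λ r → f r < g r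
sumTuples-<-witness zero    f g Σf<Σg = [] , Σf<Σg
sumTuples-<-witness (suc T) f g Σf<Σg with sumFin-<-witness _ _ Σf<Σg
... | w , Σfw<Σgw with sumTuples-<-witness T (λ r → f (w ∷ r)) (λ r → g (w ∷ r)) Σfw<Σgw
...   | r , fwr<gwr = w ∷ r , fwr<gwr

≤-sumTuples : ∀ T {n} (f : (Fin T → Fin n) → ℕ) →
  (∀ {r s} → (∀ j → r j ≡ s j) → f r ≡ f s) → ∀ r → f r ≤ sumTuples T f
≤-sumTuples zero    f f-resp r = ≤-reflexive (f-resp λ ())
≤-sumTuples (suc T) f f-resp r = begin
  f r
    ≡⟨ f-resp (λ { zero → refl ; (suc j) → refl }) ⟩
  f (r zero ∷ r ∘ suc)
    ≤⟨ ≤-sumTuples T (λ s → f (r zero ∷ s)) (λ r≗s → f-resp (cons-cong r≗s)) (r ∘ suc) ⟩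
  sumTuples T (λ s → f (r zero ∷ s))
    ≤⟨ ≤-sumFin (λ w → sumTuples T (λ s → f (w ∷ s))) (r zero) ⟩
  sumTuples (suc T) f ∎
  where
  open ≤-Reasoning
  cons-cong : ∀ {T n} {w : Fin n} {r s : Fin T → Fin n} → (∀ j → r j ≡ s j) →
    ∀ j → (w ∷ r) j ≡ (w ∷ s) j
  cons-cong r≗s zero    = refl
  cons-cong r≗s (suc j) = r≗s j

sumFin-sumTuples-comm : ∀ T {m n} (f : Fin m → (Fin T → Fin n) → ℕ) →
  sumFin (λ i → sumTuples T (f i)) ≡ sumTuples T (λ r → sumFin (λ i → f i r))
sumFin-sumTuples-comm zero    f = refl
sumFin-sumTuples-comm (suc T) f = trans (sumFin-comm (λ i w → sumTuples T (λ r → f i (w ∷ r))))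
  (sumFin-cong λ w → sumFin-sumTuples-comm T (λ i r → f i (w ∷ r)))

sumTuples-comm : ∀ K T {m n} (f : (Fin K → Fin m) → (Fin T → Fin n) → ℕ) →
  sumTuples K (λ Y → sumTuples T (f Y)) ≡ sumTuples T (λ r → sumTuples K (λ Y → f Y r))
sumTuples-comm zero    T f = refl
sumTuples-comm (suc K) T f = trans
  (sumFin-cong λ w → sumTuples-comm K T (λ Y → f (w ∷ Y)))
  (sumFin-sumTuples-comm T (λ w r → sumTuples K (λ Y → f (w ∷ Y) r)))

sumTuples-prodFin : ∀ T {n} (p : Fin n → ℕ) → sumTuples T (λ r → prodFin (p ∘ r)) ≡ sumFin p ^ T
sumTuples-prodFin zero    p = refl
sumTuples-prodFin (suc T) p = begin
  sumFin (λ w → sumTuples T (λ r → p w * prodFin (p ∘ r)))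
    ≡⟨ sumFin-cong (λ w → *-distribˡ-sumTuples T (p w) _) ⟨
  sumFin (λ w → p w * sumTuples T (λ r → prodFin (p ∘ r)))
    ≡⟨ sumFin-cong (λ w → cong (p w *_) (sumTuples-prodFin T p)) ⟩
  sumFin (λ w → p w * sumFin p ^ T)
    ≡⟨ *-distribʳ-sumFin (sumFin p ^ T) p ⟨
  sumFin p * sumFin p ^ T ∎
  where open ≡-Reasoning

rearrangement : ∀ {x y u w} → x ≤ y → u ≤ w → x * w + y * u ≤ x * u + y * w
rearrangement {x} {_} {u} x≤y u≤w with m≤n⇒∃[o]m+o≡n x≤y | m≤n⇒∃[o]m+o≡n u≤w
... | e , refl | f , refl = subst (x * (u + f) + (x + e) * u ≤_) (defect x e u f) (m≤m+n _ (e * f))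
  where
  defect : ∀ x e u f → x * (u + f) + (x + e) * u + e * f ≡ x * u + (x + e) * (u + f)
  defect = solve-∀

chebyshev : ∀ {C} (d g : Fin C → ℕ) → (∀ i j → d i ≤ d j → g i ≤ g j) →
  sumFin d * sumFin g ≤ C * sumFin (λ i → d i * g i)
chebyshev {C} d g similar = *-cancelˡ-≤ 2 (begin
  2 * (sumFin d * sumFin g)                           ≡⟨ mixed ⟩
  sumFin (λ i → sumFin (λ j → d i * g j + d j * g i)) ≤⟨ sumFin-mono-≤ (λ i → sumFin-mono-≤ (pair i)) ⟩
  sumFin (λ i → sumFin (λ j → d i * g i + d j * g j)) ≡⟨ diagonal ⟩
  2 * (C * D)                                          ∎)
  where
  open ≤-Reasoning
  D = sumFin (λ i → d i * g i)
  pair : ∀ i j → d i * g j + d j * g i ≤ d i * g i + d j * g j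
  pair i j with ≤-total (d i) (d j)
  ... | inj₁ di≤dj = rearrangement di≤dj (similar i j di≤dj)
  ... | inj₂ dj≤di = subst₂ _≤_ (+-comm (d j * g i) _) (+-comm (d j * g j) _)
                       (rearrangement dj≤di (similar j i dj≤di))
  product : sumFin d * sumFin g ≡ sumFin (λ i → sumFin (λ j → d i * g j))
  product = trans (*-distribʳ-sumFin (sumFin g) d) (sumFin-cong λ i → *-distribˡ-sumFin (d i) g)
  mixed : 2 * (sumFin d * sumFin g) ≡ sumFin (λ i → sumFin (λ j → d i * g j + d j * g i))
  mixed = sym (begin-equality
    sumFin (λ i → sumFin (λ j → d i * g j + d j * g i))
      ≡⟨ sumFin-cong (λ i → sumFin-distrib-+ (λ j → d i * g j) (λ j → d j * g i)) ⟩
    sumFin (λ i → sumFin (λ j → d i * g j) + sumFin (λ j → d j * g i))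
      ≡⟨ sumFin-distrib-+ (λ i → sumFin (λ j → d i * g j)) (λ i → sumFin (λ j → d j * g i)) ⟩
    sumFin (λ i → sumFin (λ j → d i * g j)) + sumFin (λ i → sumFin (λ j → d j * g i))
      ≡⟨ cong₂ _+_ product (trans product (sym (sumFin-comm (λ i j → d j * g i)))) ⟨
    sumFin d * sumFin g + sumFin d * sumFin g
      ≡⟨ cong (sumFin d * sumFin g +_) (+-identityʳ _) ⟨
    2 * (sumFin d * sumFin g) ∎)
  diagonal : sumFin (λ i → sumFin (λ j → d i * g i + d j * g j)) ≡ 2 * (C * D)
  diagonal = begin-equality
    sumFin (λ i → sumFin (λ j → d i * g i + d j * g j))
      ≡⟨ sumFin-cong (λ i → sumFin-distrib-+ (λ _ → d i * g i) (λ j → d j * g j)) ⟩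
    sumFin (λ i → sumFin {C} (λ _ → d i * g i) + D)
      ≡⟨ sumFin-distrib-+ (λ i → sumFin {C} (λ _ → d i * g i)) (λ _ → D) ⟩
    sumFin (λ i → sumFin {C} (λ _ → d i * g i)) + sumFin {C} (λ _ → D)
      ≡⟨ cong₂ _+_ (trans (sumFin-cong (λ i → sumFin-const C (d i * g i)))
                          (sym (*-distribˡ-sumFin C (λ i → d i * g i))))
                   (sumFin-const C D) ⟩
    C * D + C * D
      ≡⟨ cong (C * D +_) (+-identityʳ _) ⟨
    2 * (C * D) ∎

power-mean : ∀ {C} (d : Fin C → ℕ) T → sumFin d ^ T * C ≤ C ^ T * sumFin (λ i → d i ^ T)
power-mean {C} d zero = ≤-reflexive (cong (1 *_) (sym (trans (sumFin-const C 1) (*-identityʳ C))))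
power-mean {C} d (suc T) = begin
  Σd * Σd ^ T * C                  ≡⟨ *-assoc Σd _ C ⟩
  Σd * (Σd ^ T * C)                ≤⟨ *-monoʳ-≤ Σd (power-mean d T) ⟩
  Σd * (C ^ T * ΣdT)               ≡⟨ x*[y*z]≡y*[x*z] Σd (C ^ T) ΣdT ⟩
  C ^ T * (Σd * ΣdT)               ≤⟨ *-monoʳ-≤ (C ^ T) (chebyshev d (λ i → d i ^ T) (λ i j → ^-monoˡ-≤ T)) ⟩
  C ^ T * (C * sumFin (λ i → d i ^ suc T)) ≡⟨ x*[y*z]≡y*[x*z] (C ^ T) C _ ⟩
  C * (C ^ T * sumFin (λ i → d i ^ suc T)) ≡⟨ *-assoc C (C ^ T) _ ⟨
  C * C ^ T * sumFin (λ i → d i ^ suc T)   ∎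
  where
  open ≤-Reasoning
  Σd = sumFin d
  ΣdT = sumFin (λ i → d i ^ T)
  x*[y*z]≡y*[x*z] : ∀ x y z → x * (y * z) ≡ y * (x * z)
  x*[y*z]≡y*[x*z] = solve-∀

-- Colour counts of glued copies

𝟙 : Bool → ℕ
𝟙 b = if b then 1 else 0

sumFin-≟ : ∀ {n} (x : Fin n) → sumFin (λ y → 𝟙 (does (x ≟ y))) ≡ 1
sumFin-≟ {suc n} zero    = cong suc (sumFin-zero n)
sumFin-≟ {suc n} (suc x) = sumFin-≟ x

upper : ∀ {n} → (Fin n → Fin n → ℕ) → Fin n → Fin n → ℕ
upper g u w = if does (u Finₚ.<? w) then g u w else 0

sumFin²-symmetric : ∀ {n} (g : Fin n → Fin n → ℕ) → (∀ u w → g u w ≡ g w u) → (∀ u → g u u ≡ 0) →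
  sumFin (λ u → sumFin (g u)) ≡ 2 * sumFin (λ u → sumFin (upper g u))
sumFin²-symmetric g g-sym g-diag = begin
  sumFin (λ u → sumFin (g u))
    ≡⟨ sumFin-cong (λ u → sumFin-cong (split u)) ⟩
  sumFin (λ u → sumFin (λ w → upper g u w + upper g w u))
    ≡⟨ sumFin-cong (λ u → sumFin-distrib-+ (upper g u) (λ w → upper g w u)) ⟩
  sumFin (λ u → sumFin (upper g u) + sumFin (λ w → upper g w u))
    ≡⟨ sumFin-distrib-+ (λ u → sumFin (upper g u)) (λ u → sumFin (λ w → upper g w u)) ⟩
  S + sumFin (λ u → sumFin (λ w → upper g w u))
    ≡⟨ cong (S +_) (sumFin-comm (upper g)) ⟨
  S + S
    ≡⟨ cong (S +_) (+-identityʳ S) ⟨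
  2 * S ∎
  where
  open ≡-Reasoning
  S = sumFin (λ u → sumFin (upper g u))
  split : ∀ u w → g u w ≡ (if does (u Finₚ.<? w) then g u w else 0) + (if does (w Finₚ.<? u) then g w u else 0)
  split u w with does (u Finₚ.<? w) | proof (u Finₚ.<? w) | does (w Finₚ.<? u) | proof (w Finₚ.<? u)
  ... | true  | ofʸ u<w | true  | ofʸ w<u = contradiction w<u (Finₚ.<-asym u<w)
  ... | true  | ofʸ _   | false | ofⁿ _   = sym (+-identityʳ _)
  ... | false | ofⁿ _   | true  | ofʸ _   = g-sym u w
  ... | false | ofⁿ u≮w | false | ofⁿ w≮u with Finₚ.<-cmp u w
  ...   | tri< u<w _    _   = contradiction u<w u≮w
  ...   | tri≈ _   refl _   = g-diag u
  ...   | tri> _   _    w<u = contradiction w<u w≮u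

module _ {v n c} (H : Graph v) (χ : Colouring n c) where

  colourEdge : (Fin v → Fin n) → Fin c → Fin v → Fin v → ℕ
  colourEdge f γ u w = 𝟙 (adj H u w ∧ does (col χ (f u) (f w) ≟ γ))

  colourEdge-sym : ∀ f γ u w → colourEdge f γ u w ≡ colourEdge f γ w u
  colourEdge-sym f γ u w rewrite Graph.sym H u w | col-sym χ (f u) (f w) = refl

  colourEdge-≡ : ∀ f {γ u w} → col χ (f u) (f w) ≡ γ → colourEdge f γ u w ≡ 𝟙 (adj H u w)
  colourEdge-≡ f {γ} {u} {w} fufw≡γ with col χ (f u) (f w) ≟ γ
  ... | yes _     = cong 𝟙 (∧-identityʳ _)
  ... | no  fufw≢γ = contradiction fufw≡γ fufw≢γ

  colourEdge-≢ : ∀ f {γ u w} → col χ (f u) (f w) ≢ γ → colourEdge f γ u w ≡ 0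
  colourEdge-≢ f {γ} {u} {w} fufw≢γ with col χ (f u) (f w) ≟ γ
  ... | yes fufw≡γ = contradiction fufw≡γ fufw≢γ
  ... | no  _      = cong 𝟙 (∧-zeroʳ _)

  twice-colourCount : ∀ f γ → sumFin (λ u → sumFin (colourEdge f γ u)) ≡ 2 * colourCount H χ f γ
  twice-colourCount f γ = trans
    (sumFin²-symmetric (colourEdge f γ) (colourEdge-sym f γ) diagonal)
    (cong (2 *_) (sumFin-cong λ u → sumFin-cong λ w → upper≡ u w))
    where
    diagonal : ∀ u → colourEdge f γ u u ≡ 0
    diagonal u rewrite irrefl H u = refl
    upper≡ : ∀ u w → upper (colourEdge f γ) u w ≡
             𝟙 (does (u Finₚ.<? w) ∧ adj H u w ∧ does (col χ (f u) (f w) ≟ γ))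
    upper≡ u w with does (u Finₚ.<? w)
    ... | true  = refl
    ... | false = refl

  colourCount-cong : ∀ {f g} γ → (∀ u → f u ≡ g u) → colourCount H χ f γ ≡ colourCount H χ g γ
  colourCount-cong γ f≗g = sumFin-cong λ u → sumFin-cong λ w →
    cong₂ (λ x y → 𝟙 (does (u Finₚ.<? w) ∧ adj H u w ∧ does (col χ x y ≟ γ))) (f≗g u) (f≗g w)

crossColourCount : ∀ {v k l n c} → Graph v → (Fin k → Fin v) → (Fin l → Fin v) →
  Colouring n c → (Fin v → Fin n) → Fin c → ℕ
crossColourCount H ι₁ ι₂ χ f γ = sumFin λ i → sumFin λ j → colourEdge H χ f γ (ι₁ i) (ι₂ j)

crossColourCount-even : ∀ {v k l n c} (H : Graph v) (ι₁ : Fin k → Fin v) (ι₂ : Fin l → Fin v)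
  (χ : Colouring n c) (f : Fin v → Fin n) (γ₀ : Fin c) →
  (∀ i j → col χ (f (ι₁ i)) (f (ι₂ j)) ≡ γ₀) → 2 ∣ crossEdges H ι₁ ι₂ →
  ∀ γ → 2 ∣ crossColourCount H ι₁ ι₂ χ f γ
crossColourCount-even {k = k} {l} H ι₁ ι₂ χ f γ₀ cross≡γ₀ 2∣cross γ with γ₀ ≟ γ
... | yes refl =
  subst (2 ∣_) (sym (sumFin-cong λ i → sumFin-cong λ j → colourEdge-≡ H χ f (cross≡γ₀ i j))) 2∣cross
... | no  γ₀≢γ = subst (2 ∣_) (sym (begin
  crossColourCount H ι₁ ι₂ χ f γ
    ≡⟨ sumFin-cong (λ i → sumFin-cong λ j →
         colourEdge-≢ H χ f (γ₀≢γ ∘ trans (sym (cross≡γ₀ i j)))) ⟩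
  sumFin {k} (λ _ → sumFin {l} (λ _ → 0))
    ≡⟨ trans (sumFin-cong {k} (λ _ → sumFin-zero l)) (sumFin-zero k) ⟩
  0 ∎)) (2 ∣0)
  where open ≡-Reasoning

IsEvenChromatic : ∀ {v n c} → Graph v → Colouring n c → (Fin v → Fin n) → Set
IsEvenChromatic G χ f = Injective _≡_ _≡_ f × (∀ γ → 2 ∣ colourCount G χ f γ)

module _ {v k l n c} (H : Graph v) (σ : (Fin k ⊎ Fin l) ↔ Fin v) (χ : Colouring n c) where
  private
    ι₁ = to σ ∘ inj₁
    ι₂ = to σ ∘ inj₂

  colourCount-⊎ : ∀ f γ → colourCount H χ f γ ≡
    colourCount (induced H ι₁) χ (f ∘ ι₁) γ + crossColourCount H ι₁ ι₂ χ f γ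
      + colourCount (induced H ι₂) χ (f ∘ ι₂) γ
  colourCount-⊎ f γ = *-cancelˡ-≡ _ _ 2 (begin
    2 * colourCount H χ f γ
      ≡⟨ twice-colourCount H χ f γ ⟨
    sumFin (λ u → sumFin (e u))
      ≡⟨ sumFin-⊎ σ (λ u → sumFin (e u)) ⟩
    sumFin (λ i → sumFin (e (ι₁ i))) + sumFin (λ j → sumFin (e (ι₂ j)))
      ≡⟨ cong₂ _+_ (sumFin-cong λ i → sumFin-⊎ σ (e (ι₁ i)))
                   (sumFin-cong λ j → sumFin-⊎ σ (e (ι₂ j))) ⟩
    sumFin (λ i → sumFin (λ i′ → e (ι₁ i) (ι₁ i′)) + sumFin (λ j → e (ι₁ i) (ι₂ j)))
      + sumFin (λ j → sumFin (λ i → e (ι₂ j) (ι₁ i)) + sumFin (λ j′ → e (ι₂ j) (ι₂ j′)))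
      ≡⟨ cong₂ _+_ (sumFin-distrib-+ {k} _ _) (sumFin-distrib-+ {l} _ _) ⟩
    (block₁ + X) + (sumFin (λ j → sumFin (λ i → e (ι₂ j) (ι₁ i))) + block₂)
      ≡⟨ cong (λ t → (block₁ + X) + (t + block₂)) transposed ⟩
    (block₁ + X) + (X + block₂)
      ≡⟨ cong₂ (λ a b → (a + X) + (X + b)) (twice-colourCount (induced H ι₁) χ (f ∘ ι₁) γ)
                                            (twice-colourCount (induced H ι₂) χ (f ∘ ι₂) γ) ⟩
    (2 * c₁ + X) + (X + 2 * c₂)
      ≡⟨ regroup c₁ X c₂ ⟩
    2 * (c₁ + X + c₂) ∎)
    where
    open ≡-Reasoning
    e = colourEdge H χ f γ
    X = crossColourCount H ι₁ ι₂ χ f γ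
    c₁ = colourCount (induced H ι₁) χ (f ∘ ι₁) γ
    c₂ = colourCount (induced H ι₂) χ (f ∘ ι₂) γ
    block₁ = sumFin (λ i → sumFin (λ i′ → e (ι₁ i) (ι₁ i′)))
    block₂ = sumFin (λ j → sumFin (λ j′ → e (ι₂ j) (ι₂ j′)))
    transposed : sumFin (λ j → sumFin (λ i → e (ι₂ j) (ι₁ i))) ≡ X
    transposed = trans (sumFin-comm (λ j i → e (ι₂ j) (ι₁ i)))
                       (sumFin-cong λ i → sumFin-cong λ j → colourEdge-sym H χ f γ (ι₂ j) (ι₁ i))
    regroup : ∀ a x b → (2 * a + x) + (x + 2 * b) ≡ 2 * (a + x + b)
    regroup = solve-∀

  glue : (Fin k → Fin n) → (Fin l → Fin n) → Fin v → Fin n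
  glue φ ψ = [ φ , ψ ]′ ∘ from σ

  glue-inj₁ : ∀ φ ψ i → glue φ ψ (ι₁ i) ≡ φ i
  glue-inj₁ φ ψ i = cong [ φ , ψ ]′ (strictlyInverseʳ σ (inj₁ i))

  glue-inj₂ : ∀ φ ψ j → glue φ ψ (ι₂ j) ≡ ψ j
  glue-inj₂ φ ψ j = cong [ φ , ψ ]′ (strictlyInverseʳ σ (inj₂ j))

  glue-injective : ∀ {φ ψ} → Injective _≡_ _≡_ φ → Injective _≡_ _≡_ ψ → (∀ i j → φ i ≢ ψ j) →
    Injective _≡_ _≡_ (glue φ ψ)
  glue-injective {φ} {ψ} φ-inj ψ-inj disjoint {x} {y} gx≡gy = begin
    x                ≡⟨ strictlyInverseˡ σ x ⟨
    to σ (from σ x)  ≡⟨ cong (to σ) ([,]-injective (from σ x) (from σ y) gx≡gy) ⟩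
    to σ (from σ y)  ≡⟨ strictlyInverseˡ σ y ⟩
    y                ∎
    where
    open ≡-Reasoning
    [,]-injective : ∀ p q → [ φ , ψ ]′ p ≡ [ φ , ψ ]′ q → p ≡ q
    [,]-injective (inj₁ i) (inj₁ i′) φi≡φi′ = cong inj₁ (φ-inj φi≡φi′)
    [,]-injective (inj₁ i) (inj₂ j)  φi≡ψj  = contradiction φi≡ψj (disjoint i j)
    [,]-injective (inj₂ j) (inj₁ i)  ψj≡φi  = contradiction (sym ψj≡φi) (disjoint i j)
    [,]-injective (inj₂ j) (inj₂ j′) ψj≡ψj′ = cong inj₂ (ψ-inj ψj≡ψj′)

  glue-even : ∀ {φ ψ} γ₀ →
    (∀ γ → 2 ∣ colourCount (induced H ι₁) χ φ γ) →
    (∀ γ → 2 ∣ colourCount (induced H ι₂) χ ψ γ) →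
    (∀ i j → col χ (φ i) (ψ j) ≡ γ₀) → 2 ∣ crossEdges H ι₁ ι₂ →
    ∀ γ → 2 ∣ colourCount H χ (glue φ ψ) γ
  glue-even {φ} {ψ} γ₀ φ-even ψ-even cross≡γ₀ 2∣cross γ = subst (2 ∣_) (sym (colourCount-⊎ F γ))
    (∣m∣n⇒∣m+n (∣m∣n⇒∣m+n
      (subst (2 ∣_) (colourCount-cong (induced H ι₁) χ γ (sym ∘ glue-inj₁ φ ψ)) (φ-even γ))
      (crossColourCount-even H ι₁ ι₂ χ F γ₀
         (λ i j → trans (cong₂ (col χ) (glue-inj₁ φ ψ i) (glue-inj₂ φ ψ j)) (cross≡γ₀ i j)) 2∣cross γ))
      (subst (2 ∣_) (colourCount-cong (induced H ι₂) χ γ (sym ∘ glue-inj₂ φ ψ)) (ψ-even γ)))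
    where F = glue φ ψ

  glue-evenChromatic : ∀ {φ ψ} γ₀ →
    IsEvenChromatic (induced H ι₁) χ φ → IsEvenChromatic (induced H ι₂) χ ψ →
    (∀ i j → φ i ≢ ψ j) → (∀ i j → col χ (φ i) (ψ j) ≡ γ₀) → 2 ∣ crossEdges H ι₁ ι₂ →
    IsEvenChromatic H χ (glue φ ψ)
  glue-evenChromatic γ₀ (φ-inj , φ-even) (ψ-inj , ψ-even) disjoint cross≡γ₀ 2∣cross =
    glue-injective φ-inj ψ-inj disjoint , glue-even γ₀ φ-even ψ-even cross≡γ₀ 2∣cross

restrict : ∀ {m n c} → Colouring n c → (Fin m → Fin n) → Colouring m c
restrict χ e = record { col = λ i j → col χ (e i) (e j) ; col-sym = λ i j → col-sym χ (e i) (e j) }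

restrict-evenChromatic : ∀ {v m n c} {G : Graph v} {χ : Colouring n c} {e : Fin m → Fin n} {φ} →
  Injective _≡_ _≡_ e → IsEvenChromatic G (restrict χ e) φ → IsEvenChromatic G χ (e ∘ φ)
restrict-evenChromatic e-inj (φ-inj , φ-even) = φ-inj ∘ e-inj , φ-even

col-monochromatic : ∀ {n} (χ : Colouring n 1) u w → col χ u w ≡ zero
col-monochromatic χ u w with col χ u w
... | zero = refl

colourCount-monochromatic : ∀ {v n} (G : Graph v) (χ : Colouring n 1) f g γ →
  colourCount G χ f γ ≡ colourCount G χ g γ
colourCount-monochromatic G χ f g γ = sumFin-cong λ u → sumFin-cong λ w →
  cong (λ x → 𝟙 (does (u Finₚ.<? w) ∧ adj G u w ∧ does (x ≟ γ)))
       (trans (col-monochromatic χ (f u) (f w)) (sym (col-monochromatic χ (g u) (g w))))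

injective? : ∀ {k m} (f : Fin k → Fin m) → Dec (Injective _≡_ _≡_ f)
injective? f = map′ (λ inj {x} {y} → inj x y) (λ inj x y → inj)
  (Finₚ.all? λ x → Finₚ.all? λ y → (f x ≟ f y) →-dec (x ≟ y))

evenChromaticCopy? : ∀ {v n c} (G : Graph v) (χ : Colouring n c) → Dec (EvenChromaticCopy G χ)
evenChromaticCopy? G χ with Finₚ.any? (λ x → evenChromatic? (finToFun x))
  where
  evenChromatic? : ∀ f → Dec (IsEvenChromatic G χ f)
  evenChromatic? f = injective? f ×-dec Finₚ.all? (λ γ → 2 ∣? colourCount G χ f γ)
... | yes (x , copy) = yes (finToFun x , copy)
... | no  none       = no λ { (f , f-inj , f-even) → none (funToFin f , respect f f-inj f-even) }
  where
  respect : ∀ f → Injective _≡_ _≡_ f → (∀ γ → 2 ∣ colourCount G χ f γ) →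
    IsEvenChromatic G χ (finToFun (funToFin f))
  respect f f-inj f-even =
    (λ eq → f-inj (trans (sym (finToFun-funToFin f _)) (trans eq (finToFun-funToFin f _)))) ,
    (λ γ → subst (2 ∣_) (colourCount-cong G χ γ (sym ∘ finToFun-funToFin f)) (f-even γ))

-- Dependent random choice

support-embedding : ∀ {n} (p : Fin n → ℕ) → (∀ u → p u ≤ 1) → ∀ m → m ≤ sumFin p →
  Σ (Fin m → Fin n) λ e → Injective _≡_ _≡_ e × (∀ i → p (e i) ≡ 1)
support-embedding p p≤1 zero _ = (λ ()) , (λ { {()} }) , (λ ())
support-embedding {suc n} p p≤1 (suc m) m<Σp with p zero in p₀≡ | p≤1 zero
... | 0 | _ =
  let e , e-inj , pe≡1 = support-embedding (p ∘ suc) (p≤1 ∘ suc) (suc m) m<Σp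
  in suc ∘ e , e-inj ∘ Finₚ.suc-injective , pe≡1
... | 1 | _ =
  let e , e-inj , pe≡1 = support-embedding (p ∘ suc) (p≤1 ∘ suc) m (s≤s⁻¹ m<Σp)
  in zero ∷ suc ∘ e , cons-injective e-inj , λ { zero → p₀≡ ; (suc i) → pe≡1 i }
  where
  cons-injective : ∀ {m} {e : Fin m → Fin n} → Injective _≡_ _≡_ e → Injective _≡_ _≡_ (zero ∷ suc ∘ e)
  cons-injective e-inj {zero}  {zero}  _ = refl
  cons-injective e-inj {suc i} {suc j} eq = cong suc (e-inj (Finₚ.suc-injective eq))
... | 2+ _ | s≤s ()

outside : ∀ {k n} → (Fin k → Fin n) → (Fin n → ℕ) → Fin n → ℕ
outside Y p w = if does (Finₚ.any? λ i → Y i ≟ w) then 0 else p w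

outside≤1 : ∀ {k n} (Y : Fin k → Fin n) {p} → (∀ w → p w ≤ 1) → ∀ w → outside Y p w ≤ 1
outside≤1 Y p≤1 w with does (Finₚ.any? λ i → Y i ≟ w)
... | true  = z≤n
... | false = p≤1 w

outside≡1 : ∀ {k n} (Y : Fin k → Fin n) (p : Fin n → ℕ) w → outside Y p w ≡ 1 →
  (∀ i → Y i ≢ w) × p w ≡ 1
outside≡1 Y p w outside≡1 with does (Finₚ.any? λ i → Y i ≟ w) | proof (Finₚ.any? λ i → Y i ≟ w)
... | false | ofⁿ w∉Y = (λ i Yi≡w → w∉Y (i , Yi≡w)) , outside≡1

sumFin-outside : ∀ {k n} (Y : Fin k → Fin n) (p : Fin n → ℕ) → (∀ w → p w ≤ 1) →
  sumFin p ≤ sumFin (outside Y p) + k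
sumFin-outside {k} Y p p≤1 = begin
  sumFin p
    ≤⟨ sumFin-mono-≤ split ⟩
  sumFin (λ w → outside Y p w + sumFin (λ i → 𝟙 (does (Y i ≟ w))))
    ≡⟨ sumFin-distrib-+ (outside Y p) _ ⟩
  sumFin (outside Y p) + sumFin (λ w → sumFin (λ i → 𝟙 (does (Y i ≟ w))))
    ≡⟨ cong (sumFin (outside Y p) +_) (sumFin-comm (λ w i → 𝟙 (does (Y i ≟ w)))) ⟩
  sumFin (outside Y p) + sumFin (λ i → sumFin (λ w → 𝟙 (does (Y i ≟ w))))
    ≡⟨ cong (sumFin (outside Y p) +_)
            (trans (sumFin-cong (sumFin-≟ ∘ Y)) (trans (sumFin-const k 1) (*-identityʳ k))) ⟩
  sumFin (outside Y p) + k ∎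
  where
  open ≤-Reasoning
  split : ∀ w → p w ≤ outside Y p w + sumFin (λ i → 𝟙 (does (Y i ≟ w)))
  split w with does (Finₚ.any? λ i → Y i ≟ w) | proof (Finₚ.any? λ i → Y i ≟ w)
  ... | true  | ofʸ (i , Yi≡w) = begin
    p w                                   ≤⟨ p≤1 w ⟩
    1                                     ≡⟨ cong 𝟙 (dec-true (Y i ≟ w) Yi≡w) ⟨
    𝟙 (does (Y i ≟ w))                    ≤⟨ ≤-sumFin (λ i → 𝟙 (does (Y i ≟ w))) i ⟩
    sumFin (λ i → 𝟙 (does (Y i ≟ w)))     ∎
  ... | false | ofⁿ _ = m≤m+n (p w) _

CommonNeighbours : ∀ {n C k m} → Colouring n C → Fin C → (Fin k → Fin n) → (Fin m → Fin n) → Set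
CommonNeighbours χ γ Y e = Injective _≡_ _≡_ e × (∀ i j → Y i ≢ e j) × (∀ i j → col χ (Y i) (e j) ≡ γ)

-- For a colour γ and a T-tuple r, commonNbr γ r is the indicator of the common
-- γ-neighbourhood U of r. Summed over γ and r, |U| is at least C^(1-T) n^(T+1)
-- by the power mean inequality, while the k-tuples Y with fewer than m + k
-- common neighbours and r inside N(Y) (equivalently Y inside U) are few; so
-- some U is large and contains no such small tuple.
module _ {n C} (χ : Colouring n C) (k m T : ℕ) where

  joined : Fin C → Fin n → Fin n → ℕ
  joined γ u w = 𝟙 (does (col χ u w ≟ γ))

  joined≡1 : ∀ γ u w → joined γ u w ≡ 1 → col χ u w ≡ γ
  joined≡1 γ u w uw≡1 with does (col χ u w ≟ γ) | proof (col χ u w ≟ γ)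
  ... | true | ofʸ uw≡γ = uw≡γ

  commonNbr : ∀ {t} → Fin C → (Fin t → Fin n) → Fin n → ℕ
  commonNbr γ Y w = prodFin (λ i → joined γ (Y i) w)

  commonNbr≤1 : ∀ {t} γ (Y : Fin t → Fin n) w → commonNbr γ Y w ≤ 1
  commonNbr≤1 γ Y w = prodFin≤1 _ λ i → joined≤1 (does (col χ (Y i) w ≟ γ))
    where
    joined≤1 : ∀ b → 𝟙 b ≤ 1
    joined≤1 true  = ≤-refl
    joined≤1 false = z≤n

  commonNbr-cong : ∀ {t} γ {Y Y′ : Fin t → Fin n} → (∀ i → Y i ≡ Y′ i) →
    ∀ w → commonNbr γ Y w ≡ commonNbr γ Y′ w
  commonNbr-cong γ Y≗Y′ w = prodFin-cong λ i → cong (λ u → joined γ u w) (Y≗Y′ i)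

  nbhdSize : ∀ {t} → Fin C → (Fin t → Fin n) → ℕ
  nbhdSize γ Y = sumFin (commonNbr γ Y)

  nbhdSize≤n : ∀ {t} γ (Y : Fin t → Fin n) → nbhdSize γ Y ≤ n
  nbhdSize≤n γ Y = ≤-trans (sumFin-mono-≤ (commonNbr≤1 γ Y))
                           (≤-reflexive (trans (sumFin-const n 1) (*-identityʳ n)))

  degree : Fin C → Fin n → ℕ
  degree γ u = sumFin (λ w → joined γ w u)

  sumFin-degree : ∀ u → sumFin (λ γ → degree γ u) ≡ n
  sumFin-degree u = begin
    sumFin (λ γ → sumFin (λ w → joined γ w u)) ≡⟨ sumFin-comm (λ γ w → joined γ w u) ⟩
    sumFin (λ w → sumFin (λ γ → joined γ w u)) ≡⟨ sumFin-cong (λ w → sumFin-≟ (col χ w u)) ⟩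
    sumFin {n} (λ _ → 1)                       ≡⟨ trans (sumFin-const n 1) (*-identityʳ n) ⟩
    n                                          ∎
    where open ≡-Reasoning

  sumFin-nbhdSize : sumFin (λ γ → sumTuples T (nbhdSize γ)) ≡ sumFin (λ u → sumFin (λ γ → degree γ u ^ T))
  sumFin-nbhdSize = trans (sumFin-cong per-colour) (sumFin-comm (λ γ u → degree γ u ^ T))
    where
    per-colour : ∀ γ → sumTuples T (nbhdSize γ) ≡ sumFin (λ u → degree γ u ^ T)
    per-colour γ = trans (sym (sumFin-sumTuples-comm T λ u r → commonNbr γ r u))
                         (sumFin-cong λ u → sumTuples-prodFin T (λ w → joined γ w u))

  many-neighbours : C * (n * n ^ T) ≤ C ^ T * sumFin (λ γ → sumTuples T (nbhdSize γ))
  many-neighbours = begin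
    C * (n * n ^ T)
      ≡⟨ reorder C n (n ^ T) ⟩
    n * (n ^ T * C)
      ≡⟨ sumFin-const n (n ^ T * C) ⟨
    sumFin {n} (λ _ → n ^ T * C)
      ≡⟨ sumFin-cong (λ u → cong (λ x → x ^ T * C) (sumFin-degree u)) ⟨
    sumFin (λ u → sumFin (λ γ → degree γ u) ^ T * C)
      ≤⟨ sumFin-mono-≤ (λ u → power-mean (λ γ → degree γ u) T) ⟩
    sumFin (λ u → C ^ T * sumFin (λ γ → degree γ u ^ T))
      ≡⟨ *-distribˡ-sumFin {n} (C ^ T) _ ⟨
    C ^ T * sumFin (λ u → sumFin (λ γ → degree γ u ^ T))
      ≡⟨ cong (C ^ T *_) sumFin-nbhdSize ⟨
    C ^ T * sumFin (λ γ → sumTuples T (nbhdSize γ)) ∎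
    where
    open ≤-Reasoning
    reorder : ∀ a b c → a * (b * c) ≡ b * (c * a)
    reorder = solve-∀

  small : Fin C → (Fin k → Fin n) → ℕ
  small γ Y = 𝟙 (does (nbhdSize γ Y <? m + k))

  small≡0 : ∀ γ Y → small γ Y ≡ 0 → m + k ≤ nbhdSize γ Y
  small≡0 γ Y small≡0 with does (nbhdSize γ Y <? m + k) | proof (nbhdSize γ Y <? m + k)
  ... | false | ofⁿ size≮m+k = ≮⇒≥ size≮m+k

  small*nbhdSize^T : ∀ γ Y → small γ Y * nbhdSize γ Y ^ T ≤ (m + k) ^ T
  small*nbhdSize^T γ Y with does (nbhdSize γ Y <? m + k) | proof (nbhdSize γ Y <? m + k)
  ... | true  | ofʸ size<m+k = ≤-trans (≤-reflexive (+-identityʳ _)) (^-monoˡ-≤ T (<⇒≤ size<m+k))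
  ... | false | ofⁿ _ = z≤n

  badTerm : Fin C → (Fin T → Fin n) → (Fin k → Fin n) → ℕ
  badTerm γ r Y = small γ Y * prodFin (commonNbr γ Y ∘ r)

  badTerm-cong : ∀ γ r {Y Y′} → (∀ i → Y i ≡ Y′ i) → badTerm γ r Y ≡ badTerm γ r Y′
  badTerm-cong γ r Y≗Y′ = cong₂ _*_
    (cong (λ s → 𝟙 (does (s <? m + k))) (sumFin-cong (commonNbr-cong γ Y≗Y′)))
    (prodFin-cong (commonNbr-cong γ Y≗Y′ ∘ r))

  badCount : Fin C → (Fin T → Fin n) → ℕ
  badCount γ r = sumTuples k (badTerm γ r)

  few-bad : ∀ γ → sumTuples T (badCount γ) ≤ n ^ k * (m + k) ^ T
  few-bad γ = begin
    sumTuples T (λ r → sumTuples k (λ Y → badTerm γ r Y))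
      ≡⟨ sumTuples-comm k T (λ Y r → badTerm γ r Y) ⟨
    sumTuples k (λ Y → sumTuples T (λ r → small γ Y * prodFin (commonNbr γ Y ∘ r)))
      ≡⟨ sumTuples-cong k (λ Y → *-distribˡ-sumTuples T (small γ Y) _) ⟨
    sumTuples k (λ Y → small γ Y * sumTuples T (λ r → prodFin (commonNbr γ Y ∘ r)))
      ≡⟨ sumTuples-cong k (λ Y → cong (small γ Y *_) (sumTuples-prodFin T (commonNbr γ Y))) ⟩
    sumTuples k (λ Y → small γ Y * nbhdSize γ Y ^ T)
      ≤⟨ sumTuples-mono-≤ k (small*nbhdSize^T γ) ⟩
    sumTuples k (λ _ → (m + k) ^ T)
      ≡⟨ sumTuples-const k _ ⟩
    n ^ k * (m + k) ^ T ∎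
    where open ≤-Reasoning

  weighted-bad : sumFin (λ γ → sumTuples T (λ r → n * badCount γ r + m)) ≤
                 n * (C * (n ^ k * (m + k) ^ T)) + C * (n ^ T * m)
  weighted-bad = begin
    sumFin (λ γ → sumTuples T (λ r → n * badCount γ r + m))
      ≡⟨ sumFin-cong split ⟩
    sumFin (λ γ → n * sumTuples T (badCount γ) + n ^ T * m)
      ≡⟨ sumFin-distrib-+ (λ γ → n * sumTuples T (badCount γ)) _ ⟩
    sumFin (λ γ → n * sumTuples T (badCount γ)) + sumFin {C} (λ _ → n ^ T * m)
      ≡⟨ cong₂ _+_ (*-distribˡ-sumFin n (λ γ → sumTuples T (badCount γ))) (sym (sumFin-const C _)) ⟨
    n * sumFin (λ γ → sumTuples T (badCount γ)) + C * (n ^ T * m)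
      ≤⟨ +-monoˡ-≤ _ (*-monoʳ-≤ n (sumFin-mono-≤ few-bad)) ⟩
    n * sumFin {C} (λ _ → n ^ k * (m + k) ^ T) + C * (n ^ T * m)
      ≡⟨ cong (λ x → n * x + C * (n ^ T * m)) (sumFin-const C _) ⟩
    n * (C * (n ^ k * (m + k) ^ T)) + C * (n ^ T * m) ∎
    where
    open ≤-Reasoning
    split : ∀ γ → sumTuples T (λ r → n * badCount γ r + m) ≡ n * sumTuples T (badCount γ) + n ^ T * m
    split γ = trans (sumTuples-distrib-+ T _ _)
                    (cong₂ _+_ (sym (*-distribˡ-sumTuples T n (badCount γ))) (sumTuples-const T m))

  weighted-bad≤neighbours : .{{_ : NonZero C}} →
    2 * m * C ^ T ≤ n → 2 * C ^ T * n ^ k * (m + k) ^ T ≤ n ^ T →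
    sumFin (λ γ → sumTuples T (λ r → n * badCount γ r + m)) ≤ sumFin (λ γ → sumTuples T (nbhdSize γ))
  weighted-bad≤neighbours m-small T-large = *-cancelˡ-≤ (2 * C ^ T) (begin
    2 * C ^ T * sumFin (λ γ → sumTuples T (λ r → n * badCount γ r + m))
      ≤⟨ *-monoʳ-≤ (2 * C ^ T) weighted-bad ⟩
    2 * C ^ T * (n * (C * (n ^ k * (m + k) ^ T)) + C * (n ^ T * m))
      ≡⟨ regroup (C ^ T) n C (n ^ k) ((m + k) ^ T) (n ^ T) m ⟩
    C * (n * (2 * C ^ T * n ^ k * (m + k) ^ T)) + C * (n ^ T * (2 * m * C ^ T))
      ≤⟨ +-mono-≤ (*-monoʳ-≤ C (*-monoʳ-≤ n T-large)) (*-monoʳ-≤ C (*-monoʳ-≤ (n ^ T) m-small)) ⟩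
    C * (n * n ^ T) + C * (n ^ T * n)
      ≡⟨ double C n (n ^ T) ⟩
    2 * (C * (n * n ^ T))
      ≤⟨ *-monoʳ-≤ 2 many-neighbours ⟩
    2 * (C ^ T * sumFin (λ γ → sumTuples T (nbhdSize γ)))
      ≡⟨ *-assoc 2 (C ^ T) _ ⟨
    2 * C ^ T * sumFin (λ γ → sumTuples T (nbhdSize γ)) ∎)
    where
    open ≤-Reasoning
    instance
      C^T≢0 : NonZero (C ^ T)
      C^T≢0 = m^n≢0 C T
      2C^T≢0 : NonZero (2 * C ^ T)
      2C^T≢0 = m*n≢0 2 (C ^ T)
    regroup : ∀ a n C x y z m → 2 * a * (n * (C * (x * y)) + C * (z * m)) ≡
              C * (n * (2 * a * x * y)) + C * (z * (2 * m * a))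
    regroup = solve-∀
    double : ∀ C n z → C * (n * z) + C * (z * n) ≡ 2 * (C * (n * z))
    double = solve-∀

  -- The 1 + makes the comparison of the two sums strict, which yields a witness.
  good-tuple : .{{_ : NonZero n}} .{{_ : NonZero C}} →
    2 * m * C ^ T ≤ n → 2 * C ^ T * n ^ k * (m + k) ^ T ≤ n ^ T →
    ∃ λ γ → ∃ λ r → n * badCount γ r + m < suc (nbhdSize γ r)
  good-tuple m-small T-large =
    let γ , Σbad<Σnbhd = sumFin-<-witness _ _ bad<nbhd+1
        r , bad<nbhd   = sumTuples-<-witness T _ _ Σbad<Σnbhd
    in γ , r , bad<nbhd
    where
    open ≤-Reasoning
    instance
      n^T≢0 : NonZero (n ^ T)
      n^T≢0 = m^n≢0 n T
      n^T*1≢0 : NonZero (n ^ T * 1)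
      n^T*1≢0 = m*n≢0 (n ^ T) 1
      C*n^T≢0 : NonZero (C * (n ^ T * 1))
      C*n^T≢0 = m*n≢0 C (n ^ T * 1)
    bad<nbhd+1 : sumFin (λ γ → sumTuples T (λ r → n * badCount γ r + m)) <
                 sumFin (λ γ → sumTuples T (λ r → 1 + nbhdSize γ r))
    bad<nbhd+1 = begin-strict
      sumFin (λ γ → sumTuples T (λ r → n * badCount γ r + m))
        ≤⟨ weighted-bad≤neighbours m-small T-large ⟩
      sumFin (λ γ → sumTuples T (nbhdSize γ))
        <⟨ m<n+m _ (>-nonZero⁻¹ (C * (n ^ T * 1))) ⟩
      C * (n ^ T * 1) + sumFin (λ γ → sumTuples T (nbhdSize γ))
        ≡⟨ cong (_+ sumFin (λ γ → sumTuples T (nbhdSize γ))) (sumFin-const C (n ^ T * 1)) ⟨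
      sumFin {C} (λ _ → n ^ T * 1) + sumFin (λ γ → sumTuples T (nbhdSize γ))
        ≡⟨ trans (sumFin-distrib-+ (λ _ → sumTuples T (λ _ → 1)) (λ γ → sumTuples T (nbhdSize γ)))
                 (cong (_+ sumFin (λ γ → sumTuples T (nbhdSize γ)))
                       (sumFin-cong {C} λ _ → sumTuples-const T {n} 1)) ⟨
      sumFin (λ γ → sumTuples T (λ _ → 1) + sumTuples T (nbhdSize γ))
        ≡⟨ sumFin-cong (λ γ → sumTuples-distrib-+ T (λ _ → 1) (nbhdSize γ)) ⟨
      sumFin (λ γ → sumTuples T (λ r → 1 + nbhdSize γ r)) ∎

  no-bad : .{{_ : NonZero m}} → ∀ γ r → n * badCount γ r + m < suc (nbhdSize γ r) → badCount γ r ≡ 0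
  no-bad γ r bad<nbhd with badCount γ r
  ... | zero  = refl
  ... | suc b = contradiction (begin-strict
    n                     ≤⟨ m≤m*n n (suc b) ⟩
    n * suc b             <⟨ m<m+n (n * suc b) (>-nonZero⁻¹ m) ⟩
    n * suc b + m         ≤⟨ s≤s⁻¹ bad<nbhd ⟩
    nbhdSize γ r          ≤⟨ nbhdSize≤n γ r ⟩
    n                     ∎) (<-irrefl refl)
    where open ≤-Reasoning

  neighbours-outside : ∀ γ r → badCount γ r ≡ 0 →
    (Y : Fin k → Fin n) → (∀ i → commonNbr γ r (Y i) ≡ 1) → Σ (Fin m → Fin n) (CommonNeighbours χ γ Y)
  neighbours-outside γ r bad≡0 Y Y⊆U =
    let e , e-inj , e-outside = support-embedding (outside Y (commonNbr γ Y))
                                  (outside≤1 Y (commonNbr≤1 γ Y)) m enough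
    in e , e-inj , (λ i j → proj₁ (outside≡1 Y (commonNbr γ Y) (e j) (e-outside j)) i) ,
       (λ i j → joined≡1 γ (Y i) (e j)
                  (prodFin≡1⇒≡1 _ (proj₂ (outside≡1 Y (commonNbr γ Y) (e j) (e-outside j))) i))
    where
    r⊆N[Y] : prodFin (commonNbr γ Y ∘ r) ≡ 1
    r⊆N[Y] = ≡1⇒prodFin≡1 _ λ j → ≡1⇒prodFin≡1 _ λ i → begin-equality
      joined γ (Y i) (r j) ≡⟨ cong (λ x → 𝟙 (does (x ≟ γ))) (col-sym χ (Y i) (r j)) ⟩
      joined γ (r j) (Y i) ≡⟨ prodFin≡1⇒≡1 _ (Y⊆U i) j ⟩
      1                    ∎
      where open ≤-Reasoning
    not-small : m + k ≤ nbhdSize γ Y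
    not-small = small≡0 γ Y (n≤0⇒n≡0 (begin
      small γ Y                                 ≡⟨ *-identityʳ _ ⟨
      small γ Y * 1                             ≡⟨ cong (small γ Y *_) r⊆N[Y] ⟨
      badTerm γ r Y                             ≤⟨ ≤-sumTuples k (badTerm γ r) (badTerm-cong γ r) Y ⟩
      badCount γ r                              ≡⟨ bad≡0 ⟩
      0                                         ∎))
      where open ≤-Reasoning
    enough : m ≤ sumFin (outside Y (commonNbr γ Y))
    enough = +-cancelʳ-≤ k m _ (≤-trans not-small (sumFin-outside Y (commonNbr γ Y) (commonNbr≤1 γ Y)))

  dependent-random-choice : .{{_ : NonZero n}} .{{_ : NonZero C}} .{{_ : NonZero m}} →
    2 * m * C ^ T ≤ n → 2 * C ^ T * n ^ k * (m + k) ^ T ≤ n ^ T →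
    ∃ λ γ → Σ (Fin m → Fin n) λ e → Injective _≡_ _≡_ e ×
      ∀ (Y : Fin k → Fin m) → Σ (Fin m → Fin n) (CommonNeighbours χ γ (e ∘ Y))
  dependent-random-choice m-small T-large =
    let γ , r , bad<nbhd = good-tuple m-small T-large
        e , e-inj , e⊆U = support-embedding (commonNbr γ r) (commonNbr≤1 γ r) m
                            (s≤s⁻¹ (≤-trans (s≤s (m≤n+m m _)) bad<nbhd))
    in γ , e , e-inj , λ Y → neighbours-outside γ r (no-bad γ r bad<nbhd) (e ∘ Y) (e⊆U ∘ Y)

-- Monomials in n, m, C and 2

^-distribʳ-* : ∀ x y p → (x * y) ^ p ≡ x ^ p * y ^ p
^-distribʳ-* x y zero    = refl
^-distribʳ-* x y (suc p) = trans (cong (x * y *_) (^-distribʳ-* x y p)) (interchange x y (x ^ p) (y ^ p))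
  where
  interchange : ∀ x y u w → x * y * (u * w) ≡ x * u * (y * w)
  interchange = solve-∀

1+n≤2^n : ∀ n → 1 + n ≤ 2 ^ n
1+n≤2^n zero    = ≤-refl
1+n≤2^n (suc n) = begin
  2 + n         ≤⟨ +-monoʳ-≤ 1 (1+n≤2^n n) ⟩
  1 + 2 ^ n     ≤⟨ +-monoˡ-≤ (2 ^ n) (m^n>0 2 n) ⟩
  2 ^ n + 2 ^ n ≡⟨ cong (2 ^ n +_) (+-identityʳ (2 ^ n)) ⟨
  2 * 2 ^ n     ∎
  where open ≤-Reasoning

^-cancelˡ-< : ∀ b .{{_ : NonZero b}} {x y} → b ^ x < b ^ y → x < y
^-cancelˡ-< b {x} {y} b^x<b^y with x <? y
... | yes x<y = x<y
... | no  x≮y = contradiction (^-monoʳ-≤ b (≮⇒≥ x≮y)) (<⇒≱ b^x<b^y)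

-- ⟨ x , y , w , t ⟩ stands for n^x m^y C^w 2^t; inequalities between such
-- monomials stand in for linear inequalities between logarithms.
data Exponents : Set where
  ⟨_,_,_,_⟩ : ℕ → ℕ → ℕ → ℕ → Exponents

infixl 6 _⊕_
infixl 7 _⊗_

_⊕_ : Exponents → Exponents → Exponents
⟨ x , y , w , t ⟩ ⊕ ⟨ x′ , y′ , w′ , t′ ⟩ = ⟨ x + x′ , y + y′ , w + w′ , t + t′ ⟩

_⊗_ : Exponents → ℕ → Exponents
⟨ x , y , w , t ⟩ ⊗ p = ⟨ x * p , y * p , w * p , t * p ⟩

⟨⟩-cong : ∀ {x y w t x′ y′ w′ t′} → x ≡ x′ → y ≡ y′ → w ≡ w′ → t ≡ t′ →
  ⟨ x , y , w , t ⟩ ≡ ⟨ x′ , y′ , w′ , t′ ⟩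
⟨⟩-cong refl refl refl refl = refl

module Monomial (n m C : ℕ) .{{_ : NonZero n}} .{{_ : NonZero m}} .{{_ : NonZero C}} where

  ⟦_⟧ : Exponents → ℕ
  ⟦ ⟨ x , y , w , t ⟩ ⟧ = n ^ x * m ^ y * C ^ w * 2 ^ t

  ⟦⟧>0 : ∀ e → ⟦ e ⟧ > 0
  ⟦⟧>0 ⟨ x , y , w , t ⟩ =
    *-mono-< (*-mono-< (*-mono-< (m^n>0 n x) (m^n>0 m y)) (m^n>0 C w)) (m^n>0 2 t)

  ⟦⟧-⊕ : ∀ e e′ → ⟦ e ⊕ e′ ⟧ ≡ ⟦ e ⟧ * ⟦ e′ ⟧
  ⟦⟧-⊕ ⟨ x , y , w , t ⟩ ⟨ x′ , y′ , w′ , t′ ⟩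
    rewrite ^-distribˡ-+-* n x x′ | ^-distribˡ-+-* m y y′ | ^-distribˡ-+-* C w w′ | ^-distribˡ-+-* 2 t t′ =
    interchange (n ^ x) (m ^ y) (C ^ w) (2 ^ t) (n ^ x′) (m ^ y′) (C ^ w′) (2 ^ t′)
    where
    interchange : ∀ a b c d a′ b′ c′ d′ →
      a * a′ * (b * b′) * (c * c′) * (d * d′) ≡ a * b * c * d * (a′ * b′ * c′ * d′)
    interchange = solve-∀

  ⟦⟧-⊗ : ∀ e p → ⟦ e ⊗ p ⟧ ≡ ⟦ e ⟧ ^ p
  ⟦⟧-⊗ ⟨ x , y , w , t ⟩ p
    rewrite ^-distribʳ-* (n ^ x * m ^ y * C ^ w) (2 ^ t) p | ^-distribʳ-* (n ^ x * m ^ y) (C ^ w) p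
          | ^-distribʳ-* (n ^ x) (m ^ y) p
          | ^-*-assoc n x p | ^-*-assoc m y p | ^-*-assoc C w p | ^-*-assoc 2 t p = refl

  infix 4 _≺_ _≼_

  record _≺_ (e e′ : Exponents) : Set where
    constructor mk≺
    field lower : ⟦ e ⟧ < ⟦ e′ ⟧

  record _≼_ (e e′ : Exponents) : Set where
    constructor mk≼
    field lower : ⟦ e ⟧ ≤ ⟦ e′ ⟧

  ≺⇒≼ : ∀ {e e′} → e ≺ e′ → e ≼ e′
  ≺⇒≼ (mk≺ lt) = mk≼ (<⇒≤ lt)

  ≼-trans : ∀ {e₁ e₂ e₃} → e₁ ≼ e₂ → e₂ ≼ e₃ → e₁ ≼ e₃
  ≼-trans (mk≼ le₁) (mk≼ le₂) = mk≼ (≤-trans le₁ le₂)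

  ≼-≺-trans : ∀ {e₁ e₂ e₃} → e₁ ≼ e₂ → e₂ ≺ e₃ → e₁ ≺ e₃
  ≼-≺-trans (mk≼ le) (mk≺ lt) = mk≺ (≤-<-trans le lt)

  ≺-≼-trans : ∀ {e₁ e₂ e₃} → e₁ ≺ e₂ → e₂ ≼ e₃ → e₁ ≺ e₃
  ≺-≼-trans (mk≺ lt) (mk≼ le) = mk≺ (<-≤-trans lt le)

  ≼-exponents : ∀ {x y w t x′ y′ w′ t′} → x ≤ x′ → y ≤ y′ → w ≤ w′ → t ≤ t′ →
    ⟨ x , y , w , t ⟩ ≼ ⟨ x′ , y′ , w′ , t′ ⟩
  ≼-exponents x≤ y≤ w≤ t≤ = mk≼
    (*-mono-≤ (*-mono-≤ (*-mono-≤ (^-monoʳ-≤ n x≤) (^-monoʳ-≤ m y≤)) (^-monoʳ-≤ C w≤))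
              (^-monoʳ-≤ 2 t≤))

  ≺-⊕ : ∀ {e₁ e₂ e₃ e₄} → e₁ ≺ e₂ → e₃ ≼ e₄ → e₁ ⊕ e₃ ≺ e₂ ⊕ e₄
  ≺-⊕ {e₁} {e₂} {e₃} {e₄} (mk≺ lt) (mk≼ le) = mk≺ (subst₂ _<_ (sym (⟦⟧-⊕ e₁ e₃)) (sym (⟦⟧-⊕ e₂ e₄))
    (<-≤-trans (*-monoˡ-< ⟦ e₃ ⟧ {{>-nonZero (⟦⟧>0 e₃)}} lt) (*-monoʳ-≤ ⟦ e₂ ⟧ le)))

  ≺-⊗ : ∀ {e e′} p .{{_ : NonZero p}} → e ≺ e′ → e ⊗ p ≺ e′ ⊗ p
  ≺-⊗ {e} {e′} p (mk≺ lt) =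
    mk≺ (subst₂ _<_ (sym (⟦⟧-⊗ e p)) (sym (⟦⟧-⊗ e′ p)) (^-monoˡ-< p lt))

  ≼-⊗ : ∀ {e e′} p → e ≼ e′ → e ⊗ p ≼ e′ ⊗ p
  ≼-⊗ {e} {e′} p (mk≼ le) =
    mk≼ (subst₂ _≤_ (sym (⟦⟧-⊗ e p)) (sym (⟦⟧-⊗ e′ p)) (^-monoˡ-≤ p le))

  ≺-cancelʳ : ∀ {e₁ e₂} e₃ → e₁ ⊕ e₃ ≺ e₂ ⊕ e₃ → e₁ ≺ e₂
  ≺-cancelʳ {e₁} {e₂} e₃ (mk≺ lt) =
    mk≺ (*-cancelʳ-< ⟦ e₃ ⟧ _ _ (subst₂ _<_ (⟦⟧-⊕ e₁ e₃) (⟦⟧-⊕ e₂ e₃) lt))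

  ≺-n-exponent : ∀ {x x′} → ⟨ x , 0 , 0 , 0 ⟩ ≺ ⟨ x′ , 0 , 0 , 0 ⟩ → x < x′
  ≺-n-exponent {x} {x′} (mk≺ lt) = ^-cancelˡ-< n (subst₂ _<_ (drop-units (n ^ x)) (drop-units (n ^ x′)) lt)
    where
    drop-units : ∀ a → a * 1 * 1 * 1 ≡ a
    drop-units = solve-∀

  ≺-2-exponent : ∀ {t t′} → ⟨ 0 , 0 , 0 , t ⟩ ≺ ⟨ 0 , 0 , 0 , t′ ⟩ → t < t′
  ≺-2-exponent {t} {t′} (mk≺ lt) = ^-cancelˡ-< 2 (subst₂ _<_ (drop-units (2 ^ t)) (drop-units (2 ^ t′)) lt)
    where
    drop-units : ∀ a → 1 * 1 * 1 * a ≡ a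
    drop-units = solve-∀

-- The exponent estimate

linear-contradiction : ∀ k a b c d T .{{_ : NonZero k}} .{{_ : NonZero a}} .{{_ : NonZero c}} →
  3 * d < c → 3 * k * b * d < a * c →
  16 * k * c ≤ c + 16 * k * (d * suc T) →
  16 * k * (a * T * c) ≤ (a * c + a * k * T * c) + 16 * k * (a * d * T + b * k * c) → ⊥
-- With X = d T, dT-upper says X ≲ 16 c / 29 while dT-lower says X ≳ 2 c / 3.
linear-contradiction k a b c d T 3d<c too-big c-bound T-bound = <-irrefl refl (begin-strict
  160 * c                ≤⟨ *-monoʳ-≤ 160 (m≤n*m c k) ⟩
  160 * (k * c)          ≤⟨ combined ⟩
  87 * c + 48 * (3 * d)  <⟨ +-monoʳ-< (87 * c) (*-monoʳ-< 48 3d<c) ⟩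
  87 * c + 48 * c        ≡⟨ split c ⟩
  135 * c                <⟨ *-monoˡ-< c (m<m+n 135 {25} z<s) ⟩
  160 * c                ∎)
  where
  open ≤-Reasoning
  X = d * T
  3d≤c = <⇒≤ 3d<c
  split : ∀ c → 87 * c + 48 * c ≡ 135 * c
  split = solve-∀
  scaled : 48 * k * X * c ≤ 3 * d * c + 3 * d * k * T * c + 48 * k * d * X + 16 * k * (c * c)
  scaled = *-cancelˡ-≤ a (begin
    a * (48 * k * X * c)
      ≡⟨ lhs a k d T c ⟩
    3 * d * (16 * k * (a * T * c))
      ≤⟨ *-monoʳ-≤ (3 * d) T-bound ⟩
    3 * d * ((a * c + a * k * T * c) + 16 * k * (a * d * T + b * k * c))
      ≡⟨ expand a b c d k T ⟩
    a * (3 * d * c + 3 * d * k * T * c + 48 * k * d * X) + 16 * k * c * (3 * k * b * d)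
      ≤⟨ +-monoʳ-≤ (a * (3 * d * c + 3 * d * k * T * c + 48 * k * d * X))
                   (*-monoʳ-≤ (16 * k * c) (<⇒≤ too-big)) ⟩
    a * (3 * d * c + 3 * d * k * T * c + 48 * k * d * X) + 16 * k * c * (a * c)
      ≡⟨ collect a b c d k T ⟩
    a * (3 * d * c + 3 * d * k * T * c + 48 * k * d * X + 16 * k * (c * c)) ∎)
    where
    lhs : ∀ a k d T c → a * (48 * k * (d * T) * c) ≡ 3 * d * (16 * k * (a * T * c))
    lhs = solve-∀
    expand : ∀ a b c d k T → 3 * d * ((a * c + a * k * T * c) + 16 * k * (a * d * T + b * k * c)) ≡
             a * (3 * d * c + 3 * d * k * T * c + 48 * k * d * (d * T)) + 16 * k * c * (3 * k * b * d)
    expand = solve-∀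
    collect : ∀ a b c d k T → a * (3 * d * c + 3 * d * k * T * c + 48 * k * d * (d * T)) + 16 * k * c * (a * c) ≡
              a * (3 * d * c + 3 * d * k * T * c + 48 * k * d * (d * T) + 16 * k * (c * c))
    collect = solve-∀
  dT-upper : 29 * k * X ≤ 3 * d + 16 * k * c
  dT-upper = *-cancelˡ-≤ c (+-cancelʳ-≤ (19 * k * X * c) _ _ (begin
    c * (29 * k * X) + 19 * k * X * c
      ≡⟨ lhs c k X ⟩
    48 * k * X * c
      ≤⟨ scaled ⟩
    3 * d * c + 3 * d * k * T * c + 48 * k * d * X + 16 * k * (c * c)
      ≡⟨ regroup c d k X ⟩
    3 * d * c + 3 * d * k * T * c + 16 * k * X * (3 * d) + 16 * k * (c * c)
      ≤⟨ +-monoˡ-≤ (16 * k * (c * c))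
                   (+-monoʳ-≤ (3 * d * c + 3 * d * k * T * c) (*-monoʳ-≤ (16 * k * X) 3d≤c)) ⟩
    3 * d * c + 3 * d * k * T * c + 16 * k * X * c + 16 * k * (c * c)
      ≡⟨ rhs c d k T ⟩
    c * (3 * d + 16 * k * c) + 19 * k * X * c ∎))
    where
    lhs : ∀ c k X → c * (29 * k * X) + 19 * k * X * c ≡ 48 * k * X * c
    lhs = solve-∀
    regroup : ∀ c d k X → 3 * d * c + 3 * d * k * T * c + 48 * k * d * X + 16 * k * (c * c) ≡
              3 * d * c + 3 * d * k * T * c + 16 * k * X * (3 * d) + 16 * k * (c * c)
    regroup = solve-∀
    rhs : ∀ c d k T → 3 * d * c + 3 * d * k * T * c + 16 * k * (d * T) * c + 16 * k * (c * c) ≡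
          c * (3 * d + 16 * k * c) + 19 * k * (d * T) * c
    rhs = solve-∀
  dT-lower : 32 * k * c ≤ 3 * c + 48 * k * X
  dT-lower = +-cancelʳ-≤ (16 * k * c) _ _ (begin
    32 * k * c + 16 * k * c                ≡⟨ lhs k c ⟩
    3 * (16 * k * c)                       ≤⟨ *-monoʳ-≤ 3 c-bound ⟩
    3 * (c + 16 * k * (d * suc T))         ≡⟨ rhs k c d T ⟩
    3 * c + 48 * k * X + 16 * k * (3 * d)  ≤⟨ +-monoʳ-≤ (3 * c + 48 * k * X) (*-monoʳ-≤ (16 * k) 3d≤c) ⟩
    3 * c + 48 * k * X + 16 * k * c        ∎)
    where
    lhs : ∀ k c → 32 * k * c + 16 * k * c ≡ 3 * (16 * k * c)
    lhs = solve-∀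
    rhs : ∀ k c d T → 3 * (c + 16 * k * (d * suc T)) ≡ 3 * c + 48 * k * (d * T) + 16 * k * (3 * d)
    rhs = solve-∀
  combined : 160 * (k * c) ≤ 87 * c + 48 * (3 * d)
  combined = +-cancelʳ-≤ (768 * (k * c)) _ _ (begin
    160 * (k * c) + 768 * (k * c)         ≡⟨ lhs k c ⟩
    29 * (32 * k * c)                     ≤⟨ *-monoʳ-≤ 29 dT-lower ⟩
    29 * (3 * c + 48 * k * X)             ≡⟨ middle k c X ⟩
    87 * c + 48 * (29 * k * X)            ≤⟨ +-monoʳ-≤ (87 * c) (*-monoʳ-≤ 48 dT-upper) ⟩
    87 * c + 48 * (3 * d + 16 * k * c)    ≡⟨ rhs k c d ⟩
    87 * c + 48 * (3 * d) + 768 * (k * c) ∎)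
    where
    lhs : ∀ k c → 160 * (k * c) + 768 * (k * c) ≡ 29 * (32 * k * c)
    lhs = solve-∀
    middle : ∀ k c X → 29 * (3 * c + 48 * k * X) ≡ 87 * c + 48 * (29 * k * X)
    middle = solve-∀
    rhs : ∀ k c d → 87 * c + 48 * (3 * d + 16 * k * c) ≡ 87 * c + 48 * (3 * d) + 768 * (k * c)
    rhs = solve-∀

module _ {n m C : ℕ} .{{_ : NonZero n}} .{{_ : NonZero m}} .{{_ : NonZero C}} where
  open Monomial n m C

  -- In logarithms: (X − Y) log (n/m) < W log 2 and log (n/m) ≥ z log 2.
  ratio-bound : ∀ z {X Y W} → ⟨ 0 , 1 , 0 , z ⟩ ≼ ⟨ 1 , 0 , 0 , 0 ⟩ →
    ⟨ X , Y , 0 , 0 ⟩ ≺ ⟨ Y , X , 0 , W ⟩ → z * X ≤ W + z * Y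
  ratio-bound z {X} {Y} {W} n/m≥2^z h with X ≤? Y
  ... | yes X≤Y = ≤-trans (*-monoʳ-≤ z X≤Y) (m≤n+m _ W)
  ... | no  X≰Y with m≤n⇒∃[o]m+o≡n (≰⇒≥ X≰Y)
  ...   | D , refl = begin
    z * (Y + D)   ≡⟨ *-distribˡ-+ z Y D ⟩
    z * Y + z * D ≤⟨ +-monoʳ-≤ (z * Y) (<⇒≤ zD<W) ⟩
    z * Y + W     ≡⟨ +-comm (z * Y) W ⟩
    W + z * Y     ∎
    where
    open ≤-Reasoning
    excess : ⟨ D , 0 , 0 , 0 ⟩ ≺ ⟨ 0 , D , 0 , W ⟩
    excess = ≺-cancelʳ ⟨ Y , Y , 0 , 0 ⟩
      (subst₂ _≺_ (⟨⟩-cong (+-comm Y D) refl refl refl) (⟨⟩-cong refl (+-comm Y D) refl (sym (+-identityʳ W))) h)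
    [n/m]^D≥2^zD : ⟨ 0 , D , 0 , z * D ⟩ ≼ ⟨ D , 0 , 0 , 0 ⟩
    [n/m]^D≥2^zD = subst₂ _≼_ (⟨⟩-cong refl (+-identityʳ D) refl refl) (⟨⟩-cong (+-identityʳ D) refl refl refl)
      (≼-⊗ D n/m≥2^z)
    zD<W : z * D < W
    zD<W = ≺-2-exponent (≺-cancelʳ ⟨ 0 , D , 0 , 0 ⟩
      (subst₂ _≺_ (⟨⟩-cong refl refl refl (sym (+-identityʳ _))) (⟨⟩-cong refl refl refl (sym (+-identityʳ W)))
        (≼-≺-trans [n/m]^D≥2^zD excess)))

-- T is the largest exponent with 2 m C^T ≤ n, and the second condition says
-- that dependent random choice fails for it.
RandomChoiceFails : ℕ → ℕ → ℕ → ℕ → Set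
RandomChoiceFails k n m C =
  n < 2 * m ⊎ ∃ λ T → n < 2 * m * C ^ suc T × n ^ T < 2 * C ^ T * n ^ k * (m + k) ^ T

-- Exponents a, b, c, d as in ExpLe with a c > 3 k b d, and z = 16 k: n ≥ 2^(z²)
-- forces n/m ≥ 2^z, after which either way of failing random choice yields
-- linear inequalities between the exponents that cannot hold together.
module ExponentBound {k n m C a b c d : ℕ} .{{_ : NonZero n}} .{{_ : NonZero m}} .{{_ : NonZero C}}
  (k≥1 : 1 ≤ k) (C≥2 : 2 ≤ C) (n-large : 2 ^ (16 * k * (16 * k)) ≤ n)
  (ab : n ^ a * m ^ b < n ^ b) (cd : C ^ c * m ^ d < n ^ d) (too-big : 3 * k * b * d < a * c) where

  open Monomial n m C
  open ≤-Reasoning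

  z : ℕ
  z = 16 * k

  ab′ : ⟨ a , b , 0 , 0 ⟩ ≺ ⟨ b , 0 , 0 , 0 ⟩
  ab′ = mk≺ (subst₂ _<_ (pad₂ (n ^ a * m ^ b)) (pad₃ (n ^ b)) ab)
    where
    pad₂ : ∀ x → x ≡ x * 1 * 1
    pad₂ = solve-∀
    pad₃ : ∀ x → x ≡ x * 1 * 1 * 1
    pad₃ = solve-∀

  cd′ : ⟨ 0 , d , c , 0 ⟩ ≺ ⟨ d , 0 , 0 , 0 ⟩
  cd′ = mk≺ (subst₂ _<_ (reorder (C ^ c) (m ^ d)) (pad (n ^ d)) cd)
    where
    reorder : ∀ x y → x * y ≡ 1 * y * x * 1
    reorder = solve-∀
    pad : ∀ x → x ≡ x * 1 * 1 * 1
    pad = solve-∀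

  2^t≤C^t : ∀ y t → ⟨ 0 , y , 0 , t ⟩ ≼ ⟨ 0 , y , t , 0 ⟩
  2^t≤C^t y t = mk≼ (begin
    1 * m ^ y * 1 * 2 ^ t ≡⟨ reorder (m ^ y) (2 ^ t) ⟩
    m ^ y * 2 ^ t         ≤⟨ *-monoʳ-≤ (m ^ y) (^-monoˡ-≤ t C≥2) ⟩
    m ^ y * C ^ t         ≡⟨ pad (m ^ y) (C ^ t) ⟩
    1 * m ^ y * C ^ t * 1 ∎)
    where
    reorder : ∀ x y → 1 * x * 1 * y ≡ x * y
    reorder = solve-∀
    pad : ∀ x y → x * y ≡ 1 * x * y * 1
    pad = solve-∀

  n≥2^zz : ∀ p → ⟨ 0 , 0 , 0 , z * z * p ⟩ ≼ ⟨ p , 0 , 0 , 0 ⟩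
  n≥2^zz p = mk≼ (begin
    1 * 1 * 1 * 2 ^ (z * z * p) ≡⟨ *-identityˡ _ ⟩
    2 ^ (z * z * p)             ≡⟨ ^-*-assoc 2 (z * z) p ⟨
    (2 ^ (z * z)) ^ p           ≤⟨ ^-monoˡ-≤ p n-large ⟩
    n ^ p                       ≡⟨ pad (n ^ p) ⟩
    n ^ p * 1 * 1 * 1           ∎)
    where
    pad : ∀ x → x ≡ x * 1 * 1 * 1
    pad = solve-∀

  a<b : a < b
  a<b = ≺-n-exponent (≼-≺-trans (≼-exponents ≤-refl z≤n z≤n z≤n) ab′)

  d≥1 : 1 ≤ d
  d≥1 = positive d cd
    where
    positive : ∀ d → C ^ c * m ^ d < n ^ d → 1 ≤ d
    positive zero    C^c*1<1 = contradiction (subst (1 ≤_) (sym (*-identityʳ (C ^ c))) (m^n>0 C c)) (<⇒≱ C^c*1<1)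
    positive (suc _) _       = s≤s z≤n

  instance
    k≢0 : NonZero k
    k≢0 = >-nonZero k≥1
    3k≢0 : NonZero (3 * k)
    3k≢0 = m*n≢0 3 k
    a≢0 : NonZero a
    a≢0 = ≢-nonZero λ a≡0 → n≮0 (subst (λ x → 3 * k * b * d < x * c) a≡0 too-big)
    b≢0 : NonZero b
    b≢0 = >-nonZero (≤-<-trans z≤n a<b)
    c≢0 : NonZero c
    c≢0 = ≢-nonZero λ c≡0 → n≮0 (subst (3 * k * b * d <_) (trans (cong (a *_) c≡0) (*-zeroʳ a)) too-big)
    d≢0 : NonZero d
    d≢0 = >-nonZero d≥1

  bd≤ac : b * d ≤ a * c
  bd≤ac = begin
    b * d         ≤⟨ m≤n*m (b * d) (3 * k) ⟩
    3 * k * (b * d) ≡⟨ *-assoc (3 * k) b d ⟨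
    3 * k * b * d <⟨ too-big ⟩
    a * c         ∎

  3d<c : 3 * d < c
  3d<c = *-cancelˡ-< a _ _ (begin-strict
    a * (3 * d)       ≤⟨ *-monoˡ-≤ (3 * d) (<⇒≤ a<b) ⟩
    b * (3 * d)       ≤⟨ m≤n*m (b * (3 * d)) k ⟩
    k * (b * (3 * d)) ≡⟨ reorder k b d ⟩
    3 * k * b * d     <⟨ too-big ⟩
    a * c             ∎)
    where
    reorder : ∀ k b d → k * (b * (3 * d)) ≡ 3 * k * b * d
    reorder = solve-∀

  n/m≥2^z : ⟨ 0 , 1 , 0 , z ⟩ ≼ ⟨ 1 , 0 , 0 , 0 ⟩
  n/m≥2^z with ⟦ ⟨ 0 , 1 , 0 , z ⟩ ⟧ ≤? ⟦ ⟨ 1 , 0 , 0 , 0 ⟩ ⟧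
  ... | yes le = mk≼ le
  ... | no  nle = contradiction (_≺_.lower self) (<-irrefl refl)
    where
    narrow : ⟨ 1 , 0 , 0 , 0 ⟩ ≺ ⟨ 0 , 1 , 0 , z ⟩
    narrow = mk≺ (≰⇒> nle)
    narrow^ : ∀ p .{{_ : NonZero p}} → ⟨ p , 0 , 0 , 0 ⟩ ≺ ⟨ 0 , p , 0 , z * p ⟩
    narrow^ p = subst₂ _≺_ (⟨⟩-cong (+-identityʳ p) refl refl refl) (⟨⟩-cong refl (+-identityʳ p) refl refl)
      (≺-⊗ p narrow)
    n^a<2^zb : ⟨ a , 0 , 0 , 0 ⟩ ≺ ⟨ 0 , 0 , 0 , z * b ⟩
    n^a<2^zb = ≺-cancelʳ ⟨ 0 , b , 0 , 0 ⟩
      (subst₂ _≺_ (⟨⟩-cong (sym (+-identityʳ a)) refl refl refl) (⟨⟩-cong refl refl refl (sym (+-identityʳ _)))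
        (≺-≼-trans ab′ (≺⇒≼ (narrow^ b))))
    c<zd : c < z * d
    c<zd = ≺-2-exponent (≺-cancelʳ ⟨ 0 , d , 0 , 0 ⟩
      (subst₂ _≺_ (⟨⟩-cong refl refl refl (sym (+-identityʳ c))) (⟨⟩-cong refl refl refl (sym (+-identityʳ _)))
        (≼-≺-trans (2^t≤C^t d c) (≺-≼-trans cd′ (≺⇒≼ (narrow^ d))))))
    zbc≤zzbd : z * b * c ≤ z * z * (b * d)
    zbc≤zzbd = ≤-trans (*-monoʳ-≤ (z * b) (<⇒≤ c<zd)) (≤-reflexive (reorder z b d))
      where
      reorder : ∀ z b d → z * b * (z * d) ≡ z * z * (b * d)
      reorder = solve-∀
    self : ⟨ a * c , 0 , 0 , 0 ⟩ ≺ ⟨ a * c , 0 , 0 , 0 ⟩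
    self = ≺-≼-trans (≺-⊗ c n^a<2^zb)
      (≼-trans (≼-exponents z≤n z≤n z≤n zbc≤zzbd)
               (≼-trans (n≥2^zz (b * d)) (≼-exponents bd≤ac z≤n z≤n z≤n)))

  c-bound : ∀ s → n < 2 * m * C ^ s → z * c ≤ c + z * (d * s)
  c-bound s n<2mC^s = ratio-bound z n/m≥2^z (≺-cancelʳ ⟨ 0 , 0 , c * s , 0 ⟩
    (subst₂ _≺_ (⟨⟩-cong (cong (_+ 0) (*-identityˡ c)) (sym (+-identityʳ _)) refl refl)
                (⟨⟩-cong (sym (+-identityʳ _)) (cong (_+ 0) (*-identityˡ c)) (trans (+-identityʳ _) (*-comm s c))
                         (cong (_+ 0) (*-identityˡ c)))
      (≺-⊕ (≺-⊗ c n<2mC^s′) (≼-⊗ s (≺⇒≼ cd′)))))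
    where
    n<2mC^s′ : ⟨ 1 , 0 , 0 , 0 ⟩ ≺ ⟨ 0 , 1 , s , 1 ⟩
    n<2mC^s′ = mk≺ (subst₂ _<_ (pad n) (reorder m (C ^ s)) n<2mC^s)
      where
      pad : ∀ x → x ≡ x * 1 * 1 * 1 * 1
      pad = solve-∀
      reorder : ∀ x y → 2 * x * y ≡ 1 * (x * 1) * y * (2 * 1)
      reorder = solve-∀

  T-bound : ∀ T → n ^ T < 2 * C ^ T * n ^ k * (m + k) ^ T →
    z * (a * T * c) ≤ (a * c + a * k * T * c) + z * (a * d * T + b * k * c)
  T-bound T n^T-small = ratio-bound z n/m≥2^z (≺-cancelʳ ⟨ a * k * c , 0 , 0 , 0 ⟩
    (subst₂ _≺_ (⟨⟩-cong (lhs-n a T c k) (lhs-m a d T b k c) refl refl)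
                (⟨⟩-cong (rhs-n a d T b k c) (rhs-m a T c) refl (rhs-2 a k T c))
      (≺-⊕ (≺-⊗ a reduced) (≼-⊗ (k * c) (≺⇒≼ ab′)))))
    where
    m+k≤2^k*m : m + k ≤ 2 ^ k * m
    m+k≤2^k*m = begin
      m + k        ≤⟨ +-monoʳ-≤ m (m≤m*n k m) ⟩
      m + k * m    ≡⟨⟩
      (1 + k) * m  ≤⟨ *-monoˡ-≤ m (1+n≤2^n k) ⟩
      2 ^ k * m    ∎
    n^T-small′ : ⟨ T , 0 , 0 , 0 ⟩ ≺ ⟨ k , T , T , 1 + k * T ⟩
    n^T-small′ = mk≺ (begin-strict
      n ^ T * 1 * 1 * 1                   ≡⟨ pad (n ^ T) ⟨
      n ^ T                               <⟨ n^T-small ⟩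
      2 * C ^ T * n ^ k * (m + k) ^ T      ≤⟨ *-monoʳ-≤ (2 * C ^ T * n ^ k) (^-monoˡ-≤ T m+k≤2^k*m) ⟩
      2 * C ^ T * n ^ k * (2 ^ k * m) ^ T  ≡⟨ cong (2 * C ^ T * n ^ k *_) (^-distribʳ-* (2 ^ k) m T) ⟩
      2 * C ^ T * n ^ k * ((2 ^ k) ^ T * m ^ T) ≡⟨ cong (λ x → 2 * C ^ T * n ^ k * (x * m ^ T)) (^-*-assoc 2 k T) ⟩
      2 * C ^ T * n ^ k * (2 ^ (k * T) * m ^ T) ≡⟨ reorder (C ^ T) (n ^ k) (2 ^ (k * T)) (m ^ T) ⟩
      n ^ k * m ^ T * C ^ T * 2 ^ (1 + k * T) ∎)
      where
      pad : ∀ x → x ≡ x * 1 * 1 * 1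
      pad = solve-∀
      reorder : ∀ x y u w → 2 * x * y * (u * w) ≡ y * w * x * (2 * u)
      reorder = solve-∀
    reduced : ⟨ T * c , d * T , 0 , 0 ⟩ ≺ ⟨ k * c + d * T , T * c , 0 , (1 + k * T) * c ⟩
    reduced = ≺-cancelʳ ⟨ 0 , 0 , T * c , 0 ⟩
      (subst₂ _≺_ (⟨⟩-cong refl (sym (+-identityʳ _)) (*-comm c T) refl)
                  (⟨⟩-cong (sym (+-identityʳ _)) refl (+-identityʳ _) refl)
        (≺-⊕ (≺-⊗ c n^T-small′) (≼-⊗ T (≺⇒≼ cd′))))
    lhs-n : ∀ a T c k → T * c * a + a * (k * c) ≡ a * T * c + a * k * c
    lhs-n = solve-∀
    lhs-m : ∀ a d T b k c → d * T * a + b * (k * c) ≡ a * d * T + b * k * c + 0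
    lhs-m = solve-∀
    rhs-n : ∀ a d T b k c → (k * c + d * T) * a + b * (k * c) ≡ a * d * T + b * k * c + a * k * c
    rhs-n = solve-∀
    rhs-m : ∀ a T c → T * c * a + 0 ≡ a * T * c + 0
    rhs-m = solve-∀
    rhs-2 : ∀ a k T c → (1 + k * T) * c * a + 0 ≡ a * c + a * k * T * c + 0
    rhs-2 = solve-∀

  ¬randomChoiceFails : ¬ RandomChoiceFails k n m C
  ¬randomChoiceFails (inj₁ n<2m) = contradiction (begin-strict
    c                  <⟨ m<m*n c 16 (s≤s (s≤s z≤n)) ⟩
    c * 16             ≡⟨ *-comm c 16 ⟩
    16 * c             ≤⟨ *-monoˡ-≤ c (m≤m*n 16 k) ⟩
    z * c              ≤⟨ c-bound 0 (subst (n <_) (sym (*-identityʳ (2 * m))) n<2m) ⟩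
    c + z * (d * 0)    ≡⟨ cong (λ x → c + z * x) (*-zeroʳ d) ⟩
    c + z * 0          ≡⟨ cong (c +_) (*-zeroʳ z) ⟩
    c + 0              ≡⟨ +-identityʳ c ⟩
    c                  ∎) (<-irrefl refl)
  ¬randomChoiceFails (inj₂ (T , n<2mC^T+1 , n^T-small)) =
    linear-contradiction k a b c d T 3d<c too-big (c-bound (suc T) n<2mC^T+1) (T-bound T n^T-small)

power-bracket-step : ∀ {a C n} S → 1 ≤ a → 2 ≤ C → n < a * C ^ S → suc n ≮ a * C ^ S →
  a * C ^ S ≤ suc n × suc n < a * C ^ suc S
power-bracket-step {a} {C} S a≥1 C≥2 n<aC^S 1+n≮aC^S =
  ≮⇒≥ 1+n≮aC^S , ≤-<-trans n<aC^S (*-monoʳ-< a {{>-nonZero a≥1}} (^-monoʳ-< C C≥2 (n<1+n S)))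

power-bracket : ∀ {a C} n → 1 ≤ a → 2 ≤ C → n < a ⊎ ∃ λ T → a * C ^ T ≤ n × n < a * C ^ suc T
power-bracket zero a≥1 C≥2 = inj₁ a≥1
power-bracket {a} (suc n) a≥1 C≥2 with power-bracket n a≥1 C≥2
... | inj₁ n<a with suc n <? a
...   | yes 1+n<a = inj₁ 1+n<a
...   | no  1+n≮a = inj₂ (0 , power-bracket-step 0 a≥1 C≥2 (subst (n <_) (sym (*-identityʳ a)) n<a)
                                                  (1+n≮a ∘ subst (suc n <_) (*-identityʳ a)))
power-bracket {a} {C} (suc n) a≥1 C≥2 | inj₂ (T , aC^T≤n , n<aC^T+1) with suc n <? a * C ^ suc T
... | yes 1+n<aC^T+1 = inj₂ (T , m≤n⇒m≤1+n aC^T≤n , 1+n<aC^T+1)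
... | no  1+n≮aC^T+1 = inj₂ (suc T , power-bracket-step (suc T) a≥1 C≥2 n<aC^T+1 1+n≮aC^T+1)

expLe : ∀ {k n m C} .{{_ : NonZero m}} → 1 ≤ k → 2 ≤ C → 2 ^ (16 * k * (16 * k)) ≤ n →
  RandomChoiceFails k n m C → ∀ {N} → C ≤ N → ExpLe k n m N
expLe {k} {n} {m} {C} k≥1 C≥2 n-large fails {N} C≤N = ≤-trans (≤-trans (s≤s z≤n) C≥2) C≤N , bound
  where
  instance
    n≢0 : NonZero n
    n≢0 = >-nonZero (≤-trans (m^n>0 2 (16 * k * (16 * k))) n-large)
    C≢0 : NonZero C
    C≢0 = >-nonZero (≤-trans (s≤s z≤n) C≥2)
  bound : ∀ a b c d → n ^ a * m ^ b < n ^ b → N ^ c * m ^ d < n ^ d → a * c ≤ 3 * k * b * d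
  bound a b c d ab Ncd with a * c ≤? 3 * k * b * d
  ... | yes ac≤3kbd = ac≤3kbd
  ... | no  ac≰3kbd = contradiction fails
    (ExponentBound.¬randomChoiceFails {k} {n} {m} {C} {a} {b} {c} {d} k≥1 C≥2 n-large ab
      (≤-<-trans (*-monoˡ-≤ (m ^ d) (^-monoˡ-≤ c C≤N)) Ncd) (≰⇒> ac≰3kbd))

module _ {v k l} (H : Graph v) (σ : (Fin k ⊎ Fin l) ↔ Fin v)
         (2∣cross : 2 ∣ crossEdges H (to σ ∘ inj₁) (to σ ∘ inj₂)) where
  private
    G₁ = induced H (to σ ∘ inj₁)
    G₂ = induced H (to σ ∘ inj₂)

  module _ {n C} (χ : Colouring n C) (avoid : ¬ EvenChromaticCopy H χ) where

    split-avoidance : ∀ {m} γ (e : Fin m → Fin n) → Injective _≡_ _≡_ e →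
      (∀ (Y : Fin k → Fin m) → Σ (Fin m → Fin n) (CommonNeighbours χ γ (e ∘ Y))) →
      Avoidable G₁ m C ⊎ Avoidable G₂ m C
    split-avoidance γ e e-inj neighbours with evenChromaticCopy? G₁ (restrict χ e)
    ... | no  no-copy = inj₁ (restrict χ e , no-copy)
    ... | yes (φ , φ-even) with neighbours φ
    ...   | e′ , e′-inj , disjoint , colour-γ with evenChromaticCopy? G₂ (restrict χ e′)
    ...     | no  no-copy = inj₂ (restrict χ e′ , no-copy)
    ...     | yes (ψ , ψ-even) = contradiction
      (glue H σ χ (e ∘ φ) (e′ ∘ ψ) ,
       glue-evenChromatic H σ χ γ (restrict-evenChromatic {G = G₁} {χ} e-inj φ-even)
                                  (restrict-evenChromatic {G = G₂} {χ} e′-inj ψ-even)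
         (λ i j → disjoint i (ψ j)) (λ i j → colour-γ i (ψ j)) 2∣cross)
      avoid

    -- With a single colour the colour counts do not depend on the map, so the
    -- glued map (possibly not injective) can be traded for the injection f.
    one-colour : ∀ {m} → C ≡ 1 → (e : Fin m → Fin n) (f : Fin v → Fin n) → Injective _≡_ _≡_ f →
      Avoidable G₁ m C ⊎ Avoidable G₂ m C
    one-colour refl e f f-inj with evenChromaticCopy? G₁ (restrict χ e)
    ... | no  no-copy = inj₁ (restrict χ e , no-copy)
    ... | yes (φ , _ , φ-even) with evenChromaticCopy? G₂ (restrict χ e)
    ...   | no  no-copy = inj₂ (restrict χ e , no-copy)
    ...   | yes (ψ , _ , ψ-even) = contradiction (f , f-evenChromatic) avoid
      where
      f-evenChromatic : IsEvenChromatic H χ f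
      f-evenChromatic = f-inj , λ γ → subst (2 ∣_) (colourCount-monochromatic H χ _ f γ)
        (glue-even H σ χ zero φ-even ψ-even (λ i j → col-monochromatic χ _ _) 2∣cross γ)

    many-colours : ∀ {m} → 1 ≤ m → 2 ≤ C →
      Avoidable G₁ m C ⊎ Avoidable G₂ m C ⊎ RandomChoiceFails k n m C
    many-colours {m} m≥1 C≥2 with power-bracket n (≤-trans m≥1 (m≤n*m m 2)) C≥2
    ... | inj₁ n<2m = inj₂ (inj₂ (inj₁ n<2m))
    ... | inj₂ (T , 2mC^T≤n , n<2mC^T+1) with 2 * C ^ T * n ^ k * (m + k) ^ T ≤? n ^ T
    ...   | no  T-small = inj₂ (inj₂ (inj₂ (T , n<2mC^T+1 , ≰⇒> T-small)))
    ...   | yes T-large =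
      let γ , e , e-inj , neighbours = dependent-random-choice χ k m T 2mC^T≤n T-large
      in map₂ inj₁ (split-avoidance γ e e-inj neighbours)
      where
      instance
        m≢0 : NonZero m
        m≢0 = >-nonZero m≥1
        C≢0 : NonZero C
        C≢0 = >-nonZero (≤-trans (s≤s z≤n) C≥2)
        n≢0 : NonZero n
        n≢0 = >-nonZero (≤-trans (*-mono-≤ (≤-trans m≥1 (m≤n*m m 2)) (m^n>0 C T)) 2mC^T≤n)

  trichotomy : ∀ {n m C c} → 1 ≤ k → 2 ^ (16 * k * (16 * k)) ≤ n → v ≤ n → 1 ≤ m → m ≤ n → C ≤ c →
    (χ : Colouring n C) → ¬ EvenChromaticCopy H χ → Avoidable G₁ m C ⊎ Avoidable G₂ m C ⊎ ExpLe k n m c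
  trichotomy {n} {C = 0} k≥1 n-large v≤n m≥1 m≤n C≤c χ avoid =
    contradiction (col χ vertex vertex) Finₚ.¬Fin0
    where
    vertex : Fin n
    vertex = fromℕ< (≤-trans (m^n>0 2 (16 * k * (16 * k))) n-large)
  trichotomy {C = 1} k≥1 n-large v≤n m≥1 m≤n C≤c χ avoid = map₂ inj₁
    (one-colour χ avoid refl (λ i → inject≤ i m≤n) (λ u → inject≤ u v≤n) (inject≤-injective v≤n v≤n _ _))
  trichotomy {C = 2+ _} k≥1 n-large v≤n m≥1 m≤n C≤c χ avoid =
    map₂ (map₂ λ fails → expLe {{>-nonZero m≥1}} k≥1 (s≤s (s≤s z≤n)) n-large fails C≤c)
      (many-colours χ avoid m≥1 (s≤s (s≤s z≤n)))

lemma3p1 : (v k l : ℕ) (H : Graph v) (σ : Fin k ⊎ Fin l → Fin v) →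
    Bijective _≡_ _≡_ σ →
    1 ≤ k → 1 ≤ l →
    2 ∣ crossEdges H (σ ∘ inj₁) (σ ∘ inj₂) →
    Σ ℕ λ n₀ → ∀ n → n₀ ≤ n → ∀ m → 1 ≤ m → m ≤ n → ∀ c → rLe H n c →
      rLe (induced H (σ ∘ inj₁)) m c
      ⊎ (rLe (induced H (σ ∘ inj₂)) m c ⊎ ExpLe k n m c)
lemma3p1 v k l H σ bij k≥1 _ 2∣cross = 2 ^ (16 * k * (16 * k)) + v , bound
  where
  bound : ∀ n → 2 ^ (16 * k * (16 * k)) + v ≤ n → ∀ m → 1 ≤ m → m ≤ n → ∀ c → rLe H n c →
    rLe (induced H (σ ∘ inj₁)) m c ⊎ (rLe (induced H (σ ∘ inj₂)) m c ⊎ ExpLe k n m c)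
  bound n n₀≤n m m≥1 m≤n c (C , C≤c , χ , avoid) =
    map (λ avoided → C , C≤c , avoided) (map₁ λ avoided → C , C≤c , avoided)
      (trichotomy H (⤖⇒↔ (mk⤖ bij)) 2∣cross k≥1 (≤-trans (m≤m+n _ v) n₀≤n) (≤-trans (m≤n+m v _) n₀≤n)
                  m≥1 m≤n C≤c χ avoid)
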